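{- Let $\sigma$ be a coatom of the poset $\mathrm{NC}^d_n$ and suppose $\sigma=\{B_1,B_2,\dots,B_{d+1}\}$. Then the interval $[\hat0,\sigma]$ in $\mathrm{NC}^d_n$ (where $\hat0$ is the partition into singletons) satisfies $$[\hat0,\sigma]\cong\prod_{i=1}^{d+1}\mathrm{NC}^d_{|B_i|}.$$
   Context: A partition of $[n]$ is noncrossing if there are no $i<j<k<\ell$ with $i,k$ in one block and $j,\ell$ in a different block. The Kreweras dual $\pi'$ of a noncrossing partition $\pi$ of $[n]$: place $1,1',2,2',\dots,n,n'$ on a circle in this cyclic order; $\pi'$ is the coarsest partition of $\{1',\dots,n'\}$ such that the blocks of $\pi$ and of $\pi'$ together form a noncrossing partition of these $2n$ points. $\mathrm{NC}^d_n$ is the poset, ordered by refinement, of noncrossing partitions $\pi$ of $[n]$ such that every block of $\pi$ and of $\pi'$ has cardinality congruent to $1$ modulo $d$; for a finite set $B$ of size $m$, $\mathrm{NC}^d_{|B|}$ is identified with the analogous poset on $B$ (ordered increasingly). A coatom is an element covered by the maximum element $\{[n]\}$. -}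

module Defs where

open import Data.Nat using (ℕ; zero; suc; _+_; _*_; _∸_; _<_)
open import Data.Nat.Divisibility using (_∣_)
open import Data.Bool using (Bool; true; false)
open import Data.Fin using (Fin; toℕ) renaming (zero to fzero; suc to fsuc)
open import Data.Fin.Properties using (_≟_)
open import Relation.Nullary.Decidable using (⌊_⌋)
open import Data.Sum using (_⊎_; inj₁; inj₂)
open import Data.Product using (Σ; _×_; ∃; proj₁)
open import Data.Empty using (⊥)
open import Relation.Nullary using (¬_)
open import Relation.Binary.PropositionalEquality using (_≡_; refl)
open import Relation.Binary.Morphism.Structures using (IsOrderIsomorphism)

record Partition (n : ℕ) : Set where
  field
    rel   : Fin n → Fin n → Bool
    reflP : ∀ i → rel i i ≡ true
    symP  : ∀ i j → rel i j ≡ true → rel j i ≡ true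
    transP : ∀ i j k → rel i j ≡ true → rel j k ≡ true → rel i k ≡ true
open Partition public

_∼[_]_ : ∀ {n} → Fin n → Partition n → Fin n → Set
i ∼[ π ] j = rel π i j ≡ true

_≈P_ : ∀ {n} → Partition n → Partition n → Set
π ≈P ρ = ∀ i j → rel π i j ≡ rel ρ i j

_≤P_ : ∀ {n} → Partition n → Partition n → Set
π ≤P ρ = ∀ i j → i ∼[ π ] j → i ∼[ ρ ] j

countTrue : ∀ {n} → (Fin n → Bool) → ℕ
countTrue {zero}  p = 0
countTrue {suc n} p with p fzero
... | true  = suc (countTrue (λ k → p (fsuc k)))
... | false = countTrue (λ k → p (fsuc k))

blockSize : ∀ {n} → Partition n → Fin n → ℕ
blockSize π i = countTrue (rel π i)

-- every block has cardinality ≡ 1 (mod d)   (block sizes are ≥ 1)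
BlocksOneModD : ℕ → ∀ {n} → Partition n → Set
BlocksOneModD d π = ∀ i → d ∣ (blockSize π i ∸ 1)

NonCrossingOn : {X : Set} → (X → ℕ) → (X → X → Bool) → Set
NonCrossingOn {X} pos R =
  ∀ (a b c e : X) → pos a < pos b → pos b < pos c → pos c < pos e →
  ¬ (R a c ≡ true × R b e ≡ true × ¬ (R a b ≡ true))

NonCrossing : ∀ {n} → Partition n → Set
NonCrossing {n} π = NonCrossingOn toℕ (rel π)

-- The 2n points 1,1',2,2',...,n,n' in this (cyclic) order:
-- inj₁ i is the point i (position 2i), inj₂ i the point i' (position 2i+1).
pos2 : ∀ {n} → Fin n ⊎ Fin n → ℕ
pos2 (inj₁ i) = 2 * toℕ i
pos2 (inj₂ i) = suc (2 * toℕ i)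

joint : ∀ {n} → Partition n → Partition n → Fin n ⊎ Fin n → Fin n ⊎ Fin n → Bool
joint π τ (inj₁ i) (inj₁ j) = rel π i j
joint π τ (inj₂ i) (inj₂ j) = rel τ i j
joint π τ (inj₁ i) (inj₂ j) = false
joint π τ (inj₂ i) (inj₁ j) = false

JointNonCrossing : ∀ {n} → Partition n → Partition n → Set
JointNonCrossing π τ = NonCrossingOn pos2 (joint π τ)

-- τ (a partition of {1',...,n'}, indexed by Fin n) is the Kreweras dual
-- of π: the coarsest partition such that blocks of π and τ together are
-- noncrossing.
IsKrewerasDual : ∀ {n} → Partition n → Partition n → Set
IsKrewerasDual π τ =
  JointNonCrossing π τ × (∀ τ′ → JointNonCrossing π τ′ → τ′ ≤P τ)

InNC : ℕ → ∀ {n} → Partition n → Set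
InNC d π =
  NonCrossing π × BlocksOneModD d π ×
  (∀ τ → IsKrewerasDual π τ → BlocksOneModD d τ)

NCd : ℕ → ℕ → Set
NCd d n = Σ (Partition n) (InNC d)

_≈NC_ : ∀ {d n} → NCd d n → NCd d n → Set
x ≈NC y = proj₁ x ≈P proj₁ y

_≤NC_ : ∀ {d n} → NCd d n → NCd d n → Set
x ≤NC y = proj₁ x ≤P proj₁ y

topP : ∀ n → Partition n
topP n = record { rel = λ _ _ → true ; reflP = λ _ → refl
                ; symP = λ _ _ _ → refl
                ; transP = λ _ _ _ _ _ → refl }

IsCoatom : (d n : ℕ) → Partition n → Set
IsCoatom d n σ =
  InNC d (topP n) × InNC d σ ×
  σ ≤P topP n × ¬ (topP n ≤P σ) ×
  (∀ ρ → InNC d ρ → σ ≤P ρ → ρ ≤P topP n → ρ ≈P σ ⊎ ρ ≈P topP n)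

-- the interval [0̂, σ] in NC^d_n (0̂ ≤ π holds for every π)
Interval : (d n : ℕ) → Partition n → Set
Interval d n σ = Σ (Partition n) (λ π → InNC d π × π ≤P σ)

_≈I_ : ∀ {d n σ} → Interval d n σ → Interval d n σ → Set
x ≈I y = proj₁ x ≈P proj₁ y

_≤I_ : ∀ {d n σ} → Interval d n σ → Interval d n σ → Set
x ≤I y = proj₁ x ≤P proj₁ y

-- σ = {B_0, ..., B_{k-1}}: the labelling ℓ names the blocks bijectively,
-- B_b = ℓ⁻¹(b); every label is used and i ∼σ j iff ℓ i = ℓ j.
BlockLabelling : ∀ {n} → (k : ℕ) → Partition n → (Fin n → Fin k) → Set
BlockLabelling {n} k σ ℓ =
  (∀ i j → i ∼[ σ ] j → ℓ i ≡ ℓ j) ×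
  (∀ i j → ℓ i ≡ ℓ j → i ∼[ σ ] j) ×
  (∀ b → ∃ λ i → ℓ i ≡ b)

labelSize : ∀ {n k} → (Fin n → Fin k) → Fin k → ℕ
labelSize ℓ b = countTrue (λ i → ⌊ ℓ i ≟ b ⌋)

ProdNC : (d : ℕ) → ∀ {k} → (Fin k → ℕ) → Set
ProdNC d {k} m = (b : Fin k) → NCd d (m b)

_≈Π_ : ∀ {d k} {m : Fin k → ℕ} → ProdNC d m → ProdNC d m → Set
x ≈Π y = ∀ b → x b ≈NC y b

_≤Π_ : ∀ {d k} {m : Fin k → ℕ} → ProdNC d m → ProdNC d m → Set
x ≤Π y = ∀ b → x b ≤NC y b

IntervalIsoProduct : (d n : ℕ) (σ : Partition n) {k : ℕ} (m : Fin k → ℕ) → Set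
IntervalIsoProduct d n σ {k} m =
  ∃ λ (f : Interval d n σ → ProdNC d m) →
    IsOrderIsomorphism (_≈I_ {d} {n} {σ}) (_≈Π_ {d} {k} {m}) (_≤I_ {d} {n} {σ}) (_≤Π_ {d} {k} {m}) f

-- Restricting π ≤ σ to the d + 1 blocks B of σ is injective and order-preserving
-- with inverse given by gluing; the point is that it matches NC^d on both sides.
-- Noncrossingness and block sizes transfer directly, so everything rests on the
-- Kreweras complement κ of π: the complement of π ↾ B is (κ ⊓ σ) ↾ B, and
-- Euler's relation #blocks π + #blocks κ = n + 1, applied to π and to every
-- π ↾ B, shows that κ ⊓ σ has exactly d more blocks than κ.  For π = σ this
-- produces a block of kreweras σ with ≥ 2, hence ≥ d + 1, elements, at most one
-- from each B: it meets every B.  For any π ≤ σ the block of κ containing it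
-- absorbs all d extra blocks of κ ⊓ σ, so every other block of κ is a block of
-- some kreweras (π ↾ B), while that one is the union of d + 1 of them, one per B.
-- Block sizes ≡ 1 (mod d) then pass in both directions, the last block of each
-- kreweras (π ↾ B) by a second use of Euler's relation.

module Submission where

open import Defs
open import Data.Nat using (ℕ; zero; suc; _+_; _*_; _∸_; _≤_; _<_; z≤n; s≤s; pred)
open import Data.Nat.Properties hiding (_≟_; ≤ᵇ⇒≤; ≤⇒≤ᵇ)
open import Data.Nat.Divisibility using (_∣_; divides; ∣⇒≤)
open import Data.Nat.Solver using (module +-*-Solver)
open import Algebra.Properties.CommutativeMonoid.Sum +-0-commutativeMonoid
  using (sum; sum-syntax; ∑-distrib-+; ∑-comm; sum-cong-≗; sum-replicate-zero)
open import Data.Bool.Base using (Bool; true; false; not; _∧_; _xor_)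
open import Data.Bool.Properties
  using (∧-assoc; ∧-comm; ∧-identityʳ; ∧-zeroʳ; ∧-conicalˡ; ∧-conicalʳ; ¬-not; not-injective; ⇔→≡)
  renaming (_≟_ to _≟ᵇ_)
open import Data.Empty using (⊥; ⊥-elim)
open import Data.Fin using (Fin; zero; suc; toℕ; fromℕ<; inject₁; fromℕ)
open import Data.Fin.Properties
  using (toℕ-injective; toℕ-inject₁; toℕ-fromℕ; toℕ<n; injective⇒≤; _≟_; all?; any?)
open import Data.Product.Base using (∃; ∃₂; _×_; _,_; proj₁; proj₂)
open import Data.Sum.Base using (_⊎_; inj₁; inj₂; [_,_])
open import Function.Base using (_∘_)
open import Function.Bundles using (mk⇔)
open import Level using (0ℓ)
open import Relation.Binary.Bundles using (Setoid)
open import Relation.Binary.Definitions using (Tri; tri<; tri≈; tri>)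
open import Relation.Binary.Morphism.Structures using (IsOrderIsomorphism)
open import Relation.Binary.PropositionalEquality
  using (_≡_; _≢_; refl; sym; trans; cong; cong₂; subst; subst₂; module ≡-Reasoning)
import Relation.Binary.Reasoning.Setoid as SetoidReasoning
open import Relation.Binary.Structures using (IsEquivalence)
open import Relation.Nullary.Decidable using (Dec; yes; no; ⌊_⌋; ⌊⌋-map′; _→-dec_; _×-dec_; decidable-stable)
open import Relation.Nullary.Negation using (¬_; contradiction)

open +-*-Solver using (solve; _:+_; _:*_; _:=_)

isYes⇒ : ∀ {P : Set} (p? : Dec P) → ⌊ p? ⌋ ≡ true → P
isYes⇒ (yes p) _ = p

⇒isYes : ∀ {P : Set} (p? : Dec P) → P → ⌊ p? ⌋ ≡ true
⇒isYes (yes _) _ = refl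
⇒isYes (no ¬p) p = contradiction p ¬p

isNo⇒ : ∀ {P : Set} (p? : Dec P) → ⌊ p? ⌋ ≡ false → ¬ P
isNo⇒ (no ¬p) _ = ¬p

⇒isNo : ∀ {P : Set} (p? : Dec P) → ¬ P → ⌊ p? ⌋ ≡ false
⇒isNo (yes p) ¬p = contradiction p ¬p
⇒isNo (no _)  _  = refl

true≢false : ∀ {b} → b ≡ true → ¬ (b ≡ false)
true≢false refl ()

∧-by-implication : ∀ (a b : Bool) → (a ≡ true → b ≡ true) → b ∧ a ≡ a
∧-by-implication true  b a⇒b = cong (_∧ true) (a⇒b refl)
∧-by-implication false b _   = ∧-zeroʳ b

∧-intro : ∀ {a b} → a ≡ true → b ≡ true → a ∧ b ≡ true
∧-intro = cong₂ _∧_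

𝟙 : Bool → ℕ
𝟙 true  = 1
𝟙 false = 0

countTrue-suc : ∀ {n} (p : Fin (suc n) → Bool) → countTrue p ≡ 𝟙 (p zero) + countTrue (p ∘ suc)
countTrue-suc p with p zero
... | true  = refl
... | false = refl

countTrue≡∑𝟙 : ∀ {n} (p : Fin n → Bool) → countTrue p ≡ ∑[ i < n ] 𝟙 (p i)
countTrue≡∑𝟙 {zero}  p = refl
countTrue≡∑𝟙 {suc n} p = trans (countTrue-suc p) (cong (𝟙 (p zero) +_) (countTrue≡∑𝟙 (p ∘ suc)))

countTrue-cong : ∀ {n} {p q : Fin n → Bool} → (∀ i → p i ≡ q i) → countTrue p ≡ countTrue q
countTrue-cong {p = p} {q} p≗q =
  trans (countTrue≡∑𝟙 p) (trans (sum-cong-≗ (cong 𝟙 ∘ p≗q)) (sym (countTrue≡∑𝟙 q)))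

countTrue-true : ∀ {n} → countTrue {n} (λ _ → true) ≡ n
countTrue-true {zero}  = refl
countTrue-true {suc n} = cong suc (countTrue-true {n})

countTrue-split : ∀ {n} (p q : Fin n → Bool) →
  countTrue p ≡ countTrue (λ i → p i ∧ q i) + countTrue (λ i → p i ∧ not (q i))
countTrue-split {n} p q = begin
  countTrue p
    ≡⟨ countTrue≡∑𝟙 p ⟩
  ∑[ i < n ] 𝟙 (p i)
    ≡⟨ sum-cong-≗ (λ i → 𝟙-split (p i) (q i)) ⟩
  ∑[ i < n ] (𝟙 (p i ∧ q i) + 𝟙 (p i ∧ not (q i)))
    ≡⟨ ∑-distrib-+ (λ i → 𝟙 (p i ∧ q i)) (λ i → 𝟙 (p i ∧ not (q i))) ⟩
  ∑[ i < n ] 𝟙 (p i ∧ q i) + ∑[ i < n ] 𝟙 (p i ∧ not (q i))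
    ≡⟨ cong₂ _+_ (countTrue≡∑𝟙 (λ i → p i ∧ q i)) (countTrue≡∑𝟙 (λ i → p i ∧ not (q i))) ⟨
  countTrue (λ i → p i ∧ q i) + countTrue (λ i → p i ∧ not (q i)) ∎
  where
  open ≡-Reasoning
  𝟙-split : ∀ a b → 𝟙 a ≡ 𝟙 (a ∧ b) + 𝟙 (a ∧ not b)
  𝟙-split false b     = refl
  𝟙-split true  false = refl
  𝟙-split true  true  = refl

countTrue-complement : ∀ {n} (p : Fin n → Bool) → countTrue p + countTrue (not ∘ p) ≡ n
countTrue-complement {n} p = trans (sym (countTrue-split (λ _ → true) p)) (countTrue-true {n})

countTrue-mono : ∀ {n} {p q : Fin n → Bool} → (∀ i → p i ≡ true → q i ≡ true) → countTrue p ≤ countTrue q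
countTrue-mono {zero}          p⇒q = z≤n
countTrue-mono {suc n} {p} {q} p⇒q rewrite countTrue-suc p | countTrue-suc q =
  +-mono-≤ (𝟙-mono (p⇒q zero)) (countTrue-mono (p⇒q ∘ suc))
  where
  𝟙-mono : ∀ {a b} → (a ≡ true → b ≡ true) → 𝟙 a ≤ 𝟙 b
  𝟙-mono {false} _   = z≤n
  𝟙-mono {true}  a⇒b rewrite a⇒b refl = ≤-refl

countTrue-last : ∀ {n} (p : Fin (suc n) → Bool) → countTrue p ≡ countTrue (p ∘ inject₁) + 𝟙 (p (fromℕ n))
countTrue-last {zero}  p rewrite countTrue-suc p = +-comm (𝟙 (p zero)) 0
countTrue-last {suc n} p rewrite countTrue-suc p | countTrue-suc (p ∘ inject₁) | countTrue-last (p ∘ suc) =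
  sym (+-assoc (𝟙 (p zero)) _ _)

∑-𝟙-≟ : ∀ {k} (c : Fin k) (x : Bool) → ∑[ b < k ] 𝟙 (⌊ c ≟ b ⌋ ∧ x) ≡ 𝟙 x
∑-𝟙-≟ {suc k} zero    x = trans (cong (𝟙 x +_) (sum-replicate-zero k)) (+-identityʳ (𝟙 x))
∑-𝟙-≟ {suc k} (suc c) x =
  trans (sum-cong-≗ (λ b → cong (λ e → 𝟙 (e ∧ x)) (⌊⌋-map′ _ _ (c ≟ b)))) (∑-𝟙-≟ c x)

countTrue-fibres : ∀ {n k} (ℓ : Fin n → Fin k) (q : Fin n → Bool) →
  countTrue q ≡ ∑[ b < k ] countTrue (λ i → ⌊ ℓ i ≟ b ⌋ ∧ q i)
countTrue-fibres {n} {k} ℓ q = begin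
  countTrue q
    ≡⟨ countTrue≡∑𝟙 q ⟩
  ∑[ i < n ] 𝟙 (q i)
    ≡⟨ sum-cong-≗ (λ i → ∑-𝟙-≟ (ℓ i) (q i)) ⟨
  ∑[ i < n ] ∑[ b < k ] 𝟙 (⌊ ℓ i ≟ b ⌋ ∧ q i)
    ≡⟨ ∑-comm (λ i b → 𝟙 (⌊ ℓ i ≟ b ⌋ ∧ q i)) ⟩
  ∑[ b < k ] ∑[ i < n ] 𝟙 (⌊ ℓ i ≟ b ⌋ ∧ q i)
    ≡⟨ sum-cong-≗ (λ b → countTrue≡∑𝟙 (λ i → ⌊ ℓ i ≟ b ⌋ ∧ q i)) ⟨
  ∑[ b < k ] countTrue (λ i → ⌊ ℓ i ≟ b ⌋ ∧ q i) ∎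
  where open ≡-Reasoning

enum : ∀ {n} (p : Fin n → Bool) → Fin (countTrue p) → Fin n
enum {suc n} p r with p zero
enum {suc n} p zero    | true  = zero
enum {suc n} p (suc r) | true  = suc (enum (p ∘ suc) r)
enum {suc n} p r       | false = suc (enum (p ∘ suc) r)

enum-sat : ∀ {n} (p : Fin n → Bool) r → p (enum p r) ≡ true
enum-sat {suc n} p r with p zero in e
enum-sat {suc n} p zero    | true  = e
enum-sat {suc n} p (suc r) | true  = enum-sat (p ∘ suc) r
enum-sat {suc n} p r       | false = enum-sat (p ∘ suc) r

rank : ∀ {n} (p : Fin n → Bool) i → p i ≡ true → Fin (countTrue p)
rank {suc n} p zero    e with p zero
rank {suc n} p zero    e  | true  = zero
rank {suc n} p zero    () | false
rank {suc n} p (suc i) e with p zero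
... | true  = suc (rank (p ∘ suc) i e)
... | false = rank (p ∘ suc) i e

enum-rank : ∀ {n} (p : Fin n → Bool) i (e : p i ≡ true) → enum p (rank p i e) ≡ i
enum-rank {suc n} p zero    e with p zero
enum-rank {suc n} p zero    e  | true  = refl
enum-rank {suc n} p zero    () | false
enum-rank {suc n} p (suc i) e with p zero
... | true  = cong suc (enum-rank (p ∘ suc) i e)
... | false = cong suc (enum-rank (p ∘ suc) i e)

enum-< : ∀ {n} (p : Fin n → Bool) {r s} → toℕ r < toℕ s → toℕ (enum p r) < toℕ (enum p s)
enum-< {suc n} p {r} {s} r<s with p zero
enum-< {suc n} p {zero}  {suc s} r<s       | true  = s≤s z≤n
enum-< {suc n} p {suc r} {suc s} (s≤s r<s) | true  = s≤s (enum-< (p ∘ suc) r<s)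
enum-< {suc n} p         r<s               | false = s≤s (enum-< (p ∘ suc) r<s)

enum-<-reflect : ∀ {n} (p : Fin n → Bool) {r s} → toℕ (enum p r) < toℕ (enum p s) → toℕ r < toℕ s
enum-<-reflect p {r} {s} lt with <-cmp (toℕ r) (toℕ s)
... | tri< r<s _ _ = r<s
... | tri≈ _ r≡s _ = contradiction (cong (toℕ ∘ enum p) (toℕ-injective r≡s)) (<⇒≢ lt)
... | tri> _ _ s<r = contradiction (enum-< p s<r) (<-asym lt)

enum-≤-reflect : ∀ {n} (p : Fin n → Bool) {r s} → toℕ (enum p r) ≤ toℕ (enum p s) → toℕ r ≤ toℕ s
enum-≤-reflect p le = ≮⇒≥ (λ s<r → <⇒≱ (enum-< p s<r) le)

enum-≤ : ∀ {n} (p : Fin n → Bool) {r s} → toℕ r ≤ toℕ s → toℕ (enum p r) ≤ toℕ (enum p s)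
enum-≤ p le = ≮⇒≥ (λ lt → <⇒≱ (enum-<-reflect p lt) le)

enum-injective : ∀ {n} (p : Fin n → Bool) {r s} → enum p r ≡ enum p s → r ≡ s
enum-injective p e = toℕ-injective (≤-antisym (enum-≤-reflect p (≤-reflexive (cong toℕ e)))
                                             (enum-≤-reflect p (≤-reflexive (cong toℕ (sym e)))))

rank-enum : ∀ {n} (p : Fin n → Bool) r (e : p (enum p r) ≡ true) → rank p (enum p r) e ≡ r
rank-enum p r e = enum-injective p (enum-rank p (enum p r) e)

rank-irrelevant : ∀ {n} (p : Fin n → Bool) i (e e′ : p i ≡ true) → rank p i e ≡ rank p i e′
rank-irrelevant p i e e′ = enum-injective p (trans (enum-rank p i e) (sym (enum-rank p i e′)))

countTrue-∘enum : ∀ {n} (p q : Fin n → Bool) → countTrue (q ∘ enum p) ≡ countTrue (λ i → p i ∧ q i)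
countTrue-∘enum {zero}  p q = refl
countTrue-∘enum {suc n} p q with p zero
... | false = countTrue-∘enum (p ∘ suc) (q ∘ suc)
... | true with q zero
...   | true  = cong suc (countTrue-∘enum (p ∘ suc) (q ∘ suc))
...   | false = countTrue-∘enum (p ∘ suc) (q ∘ suc)

countTrue-pos : ∀ {n} (p : Fin n → Bool) {i} → p i ≡ true → 0 < countTrue p
countTrue-pos p {i} e = ≤-<-trans z≤n (toℕ<n (rank p i e))

countTrue-witness : ∀ {n} (p : Fin n → Bool) → 0 < countTrue p → ∃ λ i → p i ≡ true
countTrue-witness p pos = enum p (fromℕ< pos) , enum-sat p (fromℕ< pos)

countTrue-≤-injection : ∀ {n n′} {p : Fin n → Bool} {q : Fin n′ → Bool} (f : Fin n → Fin n′) →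
  (∀ i → p i ≡ true → q (f i) ≡ true) →
  (∀ i j → p i ≡ true → p j ≡ true → f i ≡ f j → i ≡ j) →
  countTrue p ≤ countTrue q
countTrue-≤-injection {p = p} {q} f pres inj = injective⇒≤ g-injective
  where
  g : Fin (countTrue p) → Fin (countTrue q)
  g r = rank q (f (enum p r)) (pres _ (enum-sat p r))
  g-injective : ∀ {r s} → g r ≡ g s → r ≡ s
  g-injective {r} {s} e = enum-injective p (inj _ _ (enum-sat p r) (enum-sat p s)
    (trans (sym (enum-rank q _ _)) (trans (cong (enum q) e) (enum-rank q _ _))))

countTrue-≤1 : ∀ {n} (p : Fin n → Bool) → (∀ i j → p i ≡ true → p j ≡ true → i ≡ j) → countTrue p ≤ 1
countTrue-≤1 p unique =
  countTrue-≤-injection {q = λ (_ : Fin 1) → true} (λ _ → zero) (λ _ _ → refl) (λ i j pi pj _ → unique i j pi pj)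

countTrue-false : ∀ {n} (p : Fin n → Bool) → (∀ i → p i ≡ false) → countTrue p ≡ 0
countTrue-false {zero}  p none = refl
countTrue-false {suc n} p none rewrite countTrue-suc p | none zero = countTrue-false (p ∘ suc) (none ∘ suc)

countTrue-≟ : ∀ {k} (b : Fin k) → countTrue (λ c → ⌊ c ≟ b ⌋) ≡ 1
countTrue-≟ b = ≤-antisym
  (countTrue-≤1 (λ c → ⌊ c ≟ b ⌋) (λ i j i≡b j≡b → trans (isYes⇒ (i ≟ b) i≡b) (sym (isYes⇒ (j ≟ b) j≡b))))
  (countTrue-pos (λ c → ⌊ c ≟ b ⌋) (⇒isYes (b ≟ b) refl))

∧-swapʳ : ∀ a b c → (a ∧ b) ∧ c ≡ (a ∧ c) ∧ b
∧-swapʳ false b c = refl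
∧-swapʳ true  b c = ∧-comm b c

infix 4 _≡_[mod_]

_≡_[mod_] : ℕ → ℕ → ℕ → Set
a ≡ b [mod d ] = ∃₂ λ x y → a + x * d ≡ b + y * d

module _ {d : ℕ} where

  mod-refl : ∀ {a} → a ≡ a [mod d ]
  mod-refl = 0 , 0 , refl

  mod-reflexive : ∀ {a b} → a ≡ b → a ≡ b [mod d ]
  mod-reflexive refl = mod-refl

  mod-sym : ∀ {a b} → a ≡ b [mod d ] → b ≡ a [mod d ]
  mod-sym (x , y , e) = y , x , sym e

  mod-trans : ∀ {a b c} → a ≡ b [mod d ] → b ≡ c [mod d ] → a ≡ c [mod d ]
  mod-trans {a} {b} {c} (x , y , e) (u , v , f) = x + u , y + v , (begin
    a + (x + u) * d     ≡⟨ solve 4 (λ a x u d → a :+ (x :+ u) :* d := (a :+ x :* d) :+ u :* d) refl a x u d ⟩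
    a + x * d + u * d   ≡⟨ cong (_+ u * d) e ⟩
    b + y * d + u * d   ≡⟨ solve 4 (λ b y u d → (b :+ y :* d) :+ u :* d := (b :+ u :* d) :+ y :* d) refl b y u d ⟩
    b + u * d + y * d   ≡⟨ cong (_+ y * d) f ⟩
    c + v * d + y * d   ≡⟨ solve 4 (λ c v y d → (c :+ v :* d) :+ y :* d := c :+ (y :+ v) :* d) refl c v y d ⟩
    c + (y + v) * d     ∎)
    where open ≡-Reasoning

  mod-isEquivalence : IsEquivalence _≡_[mod d ]
  mod-isEquivalence = record { refl = mod-refl ; sym = mod-sym ; trans = mod-trans }

  +-cong-mod : ∀ {a b c e} → a ≡ b [mod d ] → c ≡ e [mod d ] → a + c ≡ b + e [mod d ]
  +-cong-mod {a} {b} {c} {e} (x , y , p) (u , v , q) = x + u , y + v , (begin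
    a + c + (x + u) * d         ≡⟨ solve 5 (λ a c x u d → a :+ c :+ (x :+ u) :* d := (a :+ x :* d) :+ (c :+ u :* d)) refl a c x u d ⟩
    (a + x * d) + (c + u * d)   ≡⟨ cong₂ _+_ p q ⟩
    (b + y * d) + (e + v * d)   ≡⟨ solve 5 (λ b e y v d → (b :+ y :* d) :+ (e :+ v :* d) := b :+ e :+ (y :+ v) :* d) refl b e y v d ⟩
    b + e + (y + v) * d         ∎)
    where open ≡-Reasoning

  +-cancelˡ-mod : ∀ c {a b} → c + a ≡ c + b [mod d ] → a ≡ b [mod d ]
  +-cancelˡ-mod c {a} {b} (x , y , p) =
    x , y , +-cancelˡ-≡ c _ _ (trans (sym (+-assoc c a (x * d))) (trans p (+-assoc c b (y * d))))

  +-modulus : ∀ a → a + d ≡ a [mod d ]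
  +-modulus a = 0 , 1 , trans (+-identityʳ (a + d)) (cong (a +_) (sym (+-identityʳ d)))

  ∣∸1⇒≡1-mod : ∀ {s} → 1 ≤ s → d ∣ s ∸ 1 → s ≡ 1 [mod d ]
  ∣∸1⇒≡1-mod {suc s} _ (divides q e) = 0 , q , trans (+-identityʳ (suc s)) (cong suc e)

  ≡1-mod⇒∣∸1 : ∀ {s} → 1 ≤ s → s ≡ 1 [mod d ] → d ∣ s ∸ 1
  ≡1-mod⇒∣∸1 {suc s} _ (x , y , e) =
    divides (y ∸ x) (trans (sym (m+n∸n≡m s (x * d))) (trans (cong (λ t → pred t ∸ x * d) e) (sym (*-distribʳ-∸ d y x))))

  ∑-cong-mod : ∀ {k} (f g : Fin k → ℕ) → (∀ b → f b ≡ g b [mod d ]) → ∑[ b < k ] f b ≡ ∑[ b < k ] g b [mod d ]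
  ∑-cong-mod {zero}  f g f≡g = mod-refl
  ∑-cong-mod {suc k} f g f≡g = +-cong-mod (f≡g zero) (∑-cong-mod (λ b → f (suc b)) (λ b → g (suc b)) (λ b → f≡g (suc b)))

mod-setoid : ℕ → Setoid 0ℓ 0ℓ
mod-setoid d = record { isEquivalence = mod-isEquivalence {d} }

least : ∀ {n} (p : Fin n → Bool) {i} → p i ≡ true →
  ∃ λ j → p j ≡ true × (∀ k → toℕ k < toℕ j → p k ≡ false)
least {suc n} p {zero}  pi = zero , pi , λ k ()
least {suc n} p {suc i} pi with p zero in p0
... | true  = zero , p0 , λ k ()
... | false with least (p ∘ suc) pi
...   | j , pj , below = suc j , pj , λ { zero _ → p0 ; (suc k) (s≤s k<j) → below k k<j }

greatest : ∀ {n} (p : Fin n → Bool) {i} → p i ≡ true →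
  ∃ λ j → p j ≡ true × (∀ k → toℕ j < toℕ k → p k ≡ false)
greatest {suc n} p {i} pi with any? (λ k → p (suc k) ≟ᵇ true)
... | yes (i′ , pi′) with greatest (p ∘ suc) pi′
...   | j , pj , above = suc j , pj , λ { (suc k) (s≤s j<k) → above k j<k }
greatest {suc n} p {i} pi | no none = zero , p0 i pi , λ { (suc k) _ → ¬-not (λ pk → none (k , pk)) }
  where
  p0 : ∀ i → p i ≡ true → p zero ≡ true
  p0 zero    pi = pi
  p0 (suc i) pi = contradiction (i , pi) none

isMin : ∀ {n} → Partition n → Fin n → Bool
isMin ρ i = ⌊ all? (λ j → toℕ j <? toℕ i →-dec rel ρ i j ≟ᵇ false) ⌋

isMax : ∀ {n} → Partition n → Fin n → Bool
isMax ρ i = ⌊ all? (λ j → toℕ i <? toℕ j →-dec rel ρ i j ≟ᵇ false) ⌋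

module _ {n} (ρ : Partition n) where

  isMin-elim : ∀ {i} → isMin ρ i ≡ true → ∀ j → toℕ j < toℕ i → rel ρ i j ≡ false
  isMin-elim = isYes⇒ (all? _)

  isMin-intro : ∀ {i} → (∀ j → toℕ j < toℕ i → rel ρ i j ≡ false) → isMin ρ i ≡ true
  isMin-intro = ⇒isYes (all? _)

  isMax-elim : ∀ {i} → isMax ρ i ≡ true → ∀ j → toℕ i < toℕ j → rel ρ i j ≡ false
  isMax-elim = isYes⇒ (all? _)

  isMax-intro : ∀ {i} → (∀ j → toℕ i < toℕ j → rel ρ i j ≡ false) → isMax ρ i ≡ true
  isMax-intro = ⇒isYes (all? _)

  ¬isMin⇒smaller : ∀ {i} → isMin ρ i ≡ false → ∃ λ j → toℕ j < toℕ i × i ∼[ ρ ] j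
  ¬isMin⇒smaller {i} e with any? (λ j → (toℕ j <? toℕ i) ×-dec (rel ρ i j ≟ᵇ true))
  ... | yes found = found
  ... | no none   = ⊥-elim (true≢false (isMin-intro (λ j j<i → ¬-not (λ ij → none (j , j<i , ij)))) e)

  ¬isMax⇒larger : ∀ {i} → isMax ρ i ≡ false → ∃ λ j → toℕ i < toℕ j × i ∼[ ρ ] j
  ¬isMax⇒larger {i} e with any? (λ j → (toℕ i <? toℕ j) ×-dec (rel ρ i j ≟ᵇ true))
  ... | yes found = found
  ... | no none   = ⊥-elim (true≢false (isMax-intro (λ j i<j → ¬-not (λ ij → none (j , i<j , ij)))) e)

record Representatives {n} (ρ : Partition n) (rep : Fin n → Bool) : Set where
  field
    represent : ∀ i → ∃ λ r → rep r ≡ true × i ∼[ ρ ] r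
    unique    : ∀ {r r′} → rep r ≡ true → rep r′ ≡ true → r ∼[ ρ ] r′ → r ≡ r′

module _ {n} (ρ : Partition n) where

  isMin-representatives : Representatives ρ (isMin ρ)
  isMin-representatives = record { represent = represent ; unique = unique }
    where
    represent : ∀ i → ∃ λ r → isMin ρ r ≡ true × i ∼[ ρ ] r
    represent i with least (rel ρ i) (reflP ρ i)
    ... | r , ir , below = r , isMin-intro ρ (λ k k<r → ¬-not (λ rk →
                             true≢false (transP ρ _ _ _ ir rk) (below k k<r))) , ir
    unique : ∀ {r r′} → isMin ρ r ≡ true → isMin ρ r′ ≡ true → r ∼[ ρ ] r′ → r ≡ r′
    unique {r} {r′} m m′ rr′ with <-cmp (toℕ r) (toℕ r′)
    ... | tri< r<r′ _ _ = ⊥-elim (true≢false (symP ρ _ _ rr′) (isMin-elim ρ m′ r r<r′))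
    ... | tri≈ _ r≡r′ _ = toℕ-injective r≡r′
    ... | tri> _ _ r′<r = ⊥-elim (true≢false rr′ (isMin-elim ρ m r′ r′<r))

  isMax-representatives : Representatives ρ (isMax ρ)
  isMax-representatives = record { represent = represent ; unique = unique }
    where
    represent : ∀ i → ∃ λ r → isMax ρ r ≡ true × i ∼[ ρ ] r
    represent i with greatest (rel ρ i) (reflP ρ i)
    ... | r , ir , above = r , isMax-intro ρ (λ k r<k → ¬-not (λ rk →
                             true≢false (transP ρ _ _ _ ir rk) (above k r<k))) , ir
    unique : ∀ {r r′} → isMax ρ r ≡ true → isMax ρ r′ ≡ true → r ∼[ ρ ] r′ → r ≡ r′
    unique {r} {r′} m m′ rr′ with <-cmp (toℕ r) (toℕ r′)
    ... | tri< r<r′ _ _ = ⊥-elim (true≢false rr′ (isMax-elim ρ m r′ r<r′))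
    ... | tri≈ _ r≡r′ _ = toℕ-injective r≡r′
    ... | tri> _ _ r′<r = ⊥-elim (true≢false (symP ρ _ _ rr′) (isMax-elim ρ m′ r r′<r))

Saturated : ∀ {n} → Partition n → (Fin n → Bool) → Set
Saturated ρ S = ∀ {i j} → S i ≡ true → i ∼[ ρ ] j → S j ≡ true

blockSize-pos : ∀ {n} (ρ : Partition n) i → 0 < blockSize ρ i
blockSize-pos ρ i = countTrue-pos (rel ρ i) (reflP ρ i)

module _ {n} {ρ : Partition n} {rep} (R : Representatives ρ rep) where
  open Representatives R

  countTrue-representatives-block : ∀ i → countTrue (λ j → rep j ∧ rel ρ i j) ≡ 1
  countTrue-representatives-block i = ≤-antisym
    (countTrue-≤1 (λ j → rep j ∧ rel ρ i j) (λ a b ea eb → unique (∧-conicalˡ _ _ ea) (∧-conicalˡ _ _ eb)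
      (transP ρ _ _ _ (symP ρ _ _ (∧-conicalʳ _ _ ea)) (∧-conicalʳ _ _ eb))))
    (let (r , rep-r , ir) = represent i in countTrue-pos (λ j → rep j ∧ rel ρ i j) (∧-intro rep-r ir))

  saturated-size≡#representatives : ∀ {d} S → Saturated ρ S →
    (∀ i → S i ≡ true → blockSize ρ i ≡ 1 [mod d ]) →
    countTrue S ≡ countTrue (λ i → rep i ∧ S i) [mod d ]
  saturated-size≡#representatives {d} S = go n S S≤n
    where
    open SetoidReasoning (mod-setoid d)
    S≤n : countTrue S ≤ n
    S≤n = ≤-trans (countTrue-mono {p = S} {q = λ _ → true} (λ _ _ → refl)) (≤-reflexive (countTrue-true {n}))
    go : ∀ k S → countTrue S ≤ k → Saturated ρ S → (∀ i → S i ≡ true → blockSize ρ i ≡ 1 [mod d ]) →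
         countTrue S ≡ countTrue (λ i → rep i ∧ S i) [mod d ]
    go k S size sat one with any? (λ i → S i ≟ᵇ true)
    ... | no none = mod-reflexive (trans (countTrue-false S S-false)
                      (sym (countTrue-false _ (λ i → trans (cong (rep i ∧_) (S-false i)) (∧-zeroʳ (rep i))))))
      where
      S-false : ∀ i → S i ≡ false
      S-false i = ¬-not (λ Si → none (i , Si))
    go zero    S size sat one | yes (i , Si) = ⊥-elim (<⇒≱ (countTrue-pos S Si) size)
    go (suc k) S size sat one | yes (i , Si) = begin
      countTrue S                         ≡⟨ split-S ⟩
      blockSize ρ i + countTrue S′        ≈⟨ +-cong-mod (one i Si) (go k S′ size′ sat′ (λ j S′j → one j (∧-conicalˡ _ _ S′j))) ⟩
      1 + countTrue (λ j → rep j ∧ S′ j)  ≡⟨ split-reps ⟨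
      countTrue (λ j → rep j ∧ S j)       ∎
      where
      S′ : Fin n → Bool
      S′ j = S j ∧ not (rel ρ i j)
      block⊆S : ∀ j → S j ∧ rel ρ i j ≡ rel ρ i j
      block⊆S j = ∧-by-implication (rel ρ i j) (S j) (sat Si)
      split-S : countTrue S ≡ blockSize ρ i + countTrue S′
      split-S = trans (countTrue-split S (rel ρ i)) (cong (_+ countTrue S′) (countTrue-cong block⊆S))
      split-reps : countTrue (λ j → rep j ∧ S j) ≡ 1 + countTrue (λ j → rep j ∧ S′ j)
      split-reps = trans (countTrue-split (λ j → rep j ∧ S j) (rel ρ i)) (cong₂ _+_
        (trans (countTrue-cong (λ j → trans (∧-assoc (rep j) (S j) (rel ρ i j)) (cong (rep j ∧_) (block⊆S j))))
               (countTrue-representatives-block i))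
        (countTrue-cong (λ j → ∧-assoc (rep j) (S j) (not (rel ρ i j)))))
      sat′ : Saturated ρ S′
      sat′ {a} {b} S′a ab = ∧-intro (sat (∧-conicalˡ _ _ S′a) ab)
        (cong not (¬-not λ ib → true≢false (transP ρ _ _ _ ib (symP ρ _ _ ab)) (not-injective (∧-conicalʳ _ _ S′a))))
      size′ : countTrue S′ ≤ k
      size′ = +-cancelˡ-≤ 1 _ _ (≤-trans (+-monoˡ-≤ (countTrue S′) (blockSize-pos ρ i))
                                        (≤-trans (≤-reflexive (sym split-S)) size))

infixr 25 _⊓_

_⊓_ : ∀ {n} → Partition n → Partition n → Partition n
π ⊓ ρ = record
  { rel    = λ i j → rel π i j ∧ rel ρ i j
  ; reflP  = λ i → ∧-intro (reflP π i) (reflP ρ i)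
  ; symP   = λ i j e → ∧-intro (symP π i j (∧-conicalˡ _ _ e)) (symP ρ i j (∧-conicalʳ _ _ e))
  ; transP = λ i j k e f → ∧-intro (transP π i j k (∧-conicalˡ _ _ e) (∧-conicalˡ _ _ f))
                                   (transP ρ i j k (∧-conicalʳ _ _ e) (∧-conicalʳ _ _ f))
  }

isMax-cong : ∀ {n} {ρ ρ′ : Partition n} → ρ ≈P ρ′ → ∀ i → isMax ρ i ≡ isMax ρ′ i
isMax-cong {ρ = ρ} {ρ′} ρ≈ρ′ i = ⇔→≡ (mk⇔
  (λ max → isMax-intro ρ′ (λ j i<j → trans (sym (ρ≈ρ′ i j)) (isMax-elim ρ max j i<j)))
  (λ max → isMax-intro ρ  (λ j i<j → trans (ρ≈ρ′ i j) (isMax-elim ρ′ max j i<j))))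

blockSize-∼ : ∀ {n} (ρ : Partition n) {i j} → i ∼[ ρ ] j → blockSize ρ i ≡ blockSize ρ j
blockSize-∼ ρ {i} {j} i∼j = countTrue-cong {p = rel ρ i} {rel ρ j} λ k →
  ⇔→≡ (mk⇔ (transP ρ j i k (symP ρ i j i∼j)) (transP ρ i j k i∼j))

module _ {n} (π ρ : Partition n) {i j : Fin n} where

  ⊓-elimˡ : i ∼[ π ⊓ ρ ] j → i ∼[ π ] j
  ⊓-elimˡ = ∧-conicalˡ (rel π i j) (rel ρ i j)

  ⊓-elimʳ : i ∼[ π ⊓ ρ ] j → i ∼[ ρ ] j
  ⊓-elimʳ = ∧-conicalʳ (rel π i j) (rel ρ i j)

blockSize-cong : ∀ {n} {ρ ρ′ : Partition n} → ρ ≈P ρ′ → ∀ i → blockSize ρ i ≡ blockSize ρ′ i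
blockSize-cong ρ≈ρ′ i = countTrue-cong (ρ≈ρ′ i)

noncrossing-cong : ∀ {n} {ρ ρ′ : Partition n} → ρ ≈P ρ′ → NonCrossing ρ → NonCrossing ρ′
noncrossing-cong ρ≈ρ′ nc a b c e a<b b<c c<e (ac , be , ¬ab) =
  nc a b c e a<b b<c c<e (trans (ρ≈ρ′ a c) ac , trans (ρ≈ρ′ b e) be , λ ab → ¬ab (trans (sym (ρ≈ρ′ a b)) ab))

≤P-antisym : ∀ {n} {ρ ρ′ : Partition n} → ρ ≤P ρ′ → ρ′ ≤P ρ → ρ ≈P ρ′
≤P-antisym ρ≤ρ′ ρ′≤ρ i j = ⇔→≡ (mk⇔ (ρ≤ρ′ i j) (ρ′≤ρ i j))

double<suc-double⇒≤ : ∀ {a b} → 2 * a < suc (2 * b) → a ≤ b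
double<suc-double⇒≤ (s≤s le) = *-cancelˡ-≤ 2 le

suc-double<double⇒< : ∀ {a b} → suc (2 * a) < 2 * b → a < b
suc-double<double⇒< lt = *-cancelˡ-< 2 _ _ (<-trans (n<1+n _) lt)

suc-double<suc-double⇒< : ∀ {a b} → suc (2 * a) < suc (2 * b) → a < b
suc-double<suc-double⇒< (s≤s lt) = *-cancelˡ-< 2 _ _ lt

≤⇒double<suc-double : ∀ {a b} → a ≤ b → 2 * a < suc (2 * b)
≤⇒double<suc-double le = s≤s (*-monoʳ-≤ 2 le)

<⇒suc-double<double : ∀ {a b} → a < b → suc (2 * a) < 2 * b
<⇒suc-double<double {a} lt = ≤-trans (≤-reflexive (cong suc (sym (+-suc a (a + 0))))) (*-monoʳ-≤ 2 lt)

infix 5 _≤ᵇ_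

_≤ᵇ_ : ∀ {n} → Fin n → Fin n → Bool
x ≤ᵇ t = ⌊ toℕ x ≤? toℕ t ⌋

module _ {n} {x t : Fin n} where

  ≤ᵇ⇒≤ : x ≤ᵇ t ≡ true → toℕ x ≤ toℕ t
  ≤ᵇ⇒≤ = isYes⇒ (toℕ x ≤? toℕ t)

  ≤⇒≤ᵇ : toℕ x ≤ toℕ t → x ≤ᵇ t ≡ true
  ≤⇒≤ᵇ = ⇒isYes (toℕ x ≤? toℕ t)

  ≰ᵇ⇒> : x ≤ᵇ t ≡ false → toℕ t < toℕ x
  ≰ᵇ⇒> e = ≰⇒> (isNo⇒ (toℕ x ≤? toℕ t) e)

  >⇒≰ᵇ : toℕ t < toℕ x → x ≤ᵇ t ≡ false
  >⇒≰ᵇ t<x = ⇒isNo (toℕ x ≤? toℕ t) (<⇒≱ t<x)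

-- Cutting the circle at i′ and at n′ leaves 1, …, i on one side.  For i < j, a
-- chord {x, y} separates i′ from j′ iff exactly one of x, y lies in (i, j], i.e.
-- iff the cuts at i′ and at j′ split {x, y} differently.
cutSplits : ∀ {n} → Fin n → Fin n → Fin n → Bool
cutSplits t x y = (x ≤ᵇ t) xor (y ≤ᵇ t)

cutSplits-values : ∀ {n} {t x y : Fin n} {u v} → x ≤ᵇ t ≡ u → y ≤ᵇ t ≡ v → cutSplits t x y ≡ u xor v
cutSplits-values refl refl = refl

-- The Kreweras dual made explicit: i′ and j′ share a block iff no chord
-- inside a block of π separates them.
krewerasRel : ∀ {n} → Partition n → Fin n → Fin n → Bool
krewerasRel π i j = ⌊ all? (λ x → all? (λ y → (rel π x y ≟ᵇ true) →-dec (cutSplits i x y ≟ᵇ cutSplits j x y))) ⌋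

module _ {n} (π : Partition n) where

  krewerasRel-elim : ∀ {i j} → krewerasRel π i j ≡ true → ∀ x y → x ∼[ π ] y → cutSplits i x y ≡ cutSplits j x y
  krewerasRel-elim = isYes⇒ (all? _)

  krewerasRel-intro : ∀ {i j} → (∀ x y → x ∼[ π ] y → cutSplits i x y ≡ cutSplits j x y) → krewerasRel π i j ≡ true
  krewerasRel-intro = ⇒isYes (all? _)

kreweras : ∀ {n} → Partition n → Partition n
kreweras π = record
  { rel    = krewerasRel π
  ; reflP  = λ i → krewerasRel-intro π (λ _ _ _ → refl)
  ; symP   = λ i j e → krewerasRel-intro π (λ x y xy → sym (krewerasRel-elim π e x y xy))
  ; transP = λ i j k e f → krewerasRel-intro π (λ x y xy → trans (krewerasRel-elim π e x y xy) (krewerasRel-elim π f x y xy))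
  }

≤ᵇ-trans : ∀ {n} {x s t : Fin n} → x ≤ᵇ s ≡ true → toℕ s ≤ toℕ t → x ≤ᵇ t ≡ true
≤ᵇ-trans x≤s s≤t = ≤⇒≤ᵇ (≤-trans (≤ᵇ⇒≤ x≤s) s≤t)

record Between {n} (i j x : Fin n) : Set where
  constructor between
  field
    above-lower : x ≤ᵇ i ≡ false
    below-upper : x ≤ᵇ j ≡ true

data Outside {n} (i j y : Fin n) : Set where
  below : y ≤ᵇ i ≡ true  → Outside i j y
  above : y ≤ᵇ j ≡ false → Outside i j y

between-disjoint : ∀ {n} {a b c e x : Fin n} → toℕ b ≤ toℕ c → Between a b x → ¬ Between c e x
between-disjoint b≤c (between _ x≤b) (between x≰c _) = true≢false (≤ᵇ-trans x≤b b≤c) x≰c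

cuts-disagree⇒straddle : ∀ {n} {i j : Fin n} x y → toℕ i < toℕ j → cutSplits i x y ≢ cutSplits j x y →
  (Between i j x × Outside i j y) ⊎ (Between i j y × Outside i j x)
cuts-disagree⇒straddle {i = i} {j} x y i<j ne
  with x ≤ᵇ i in x≤i | x ≤ᵇ j in x≤j | y ≤ᵇ i in y≤i | y ≤ᵇ j in y≤j
... | true  | false | _     | _     = ⊥-elim (true≢false (≤ᵇ-trans x≤i (<⇒≤ i<j)) x≤j)
... | _     | _     | true  | false = ⊥-elim (true≢false (≤ᵇ-trans y≤i (<⇒≤ i<j)) y≤j)
... | false | false | false | false = contradiction refl ne
... | false | false | false | true  = inj₂ (between y≤i y≤j , above x≤j)
... | false | false | true  | true  = contradiction refl ne
... | false | true  | false | false = inj₁ (between x≤i x≤j , above y≤j)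
... | false | true  | false | true  = contradiction refl ne
... | false | true  | true  | true  = inj₁ (between x≤i x≤j , below y≤i)
... | true  | true  | false | false = contradiction refl ne
... | true  | true  | false | true  = inj₂ (between y≤i y≤j , below x≤i)
... | true  | true  | true  | true  = contradiction refl ne

cuts-agree : ∀ {n} {i j x y : Fin n} → toℕ i < toℕ j →
  ¬ (Between i j x × Outside i j y) → ¬ (Between i j y × Outside i j x) → cutSplits i x y ≡ cutSplits j x y
cuts-agree {i = i} {j} {x} {y} i<j no-xy no-yx =
  decidable-stable (cutSplits i x y ≟ᵇ cutSplits j x y) λ disagree → [ no-xy , no-yx ] (cuts-disagree⇒straddle x y i<j disagree)

cutSplits-across : ∀ {n} {t x y : Fin n} → toℕ x ≤ toℕ t → toℕ t < toℕ y → cutSplits t x y ≡ true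
cutSplits-across x≤t t<y = cutSplits-values (≤⇒≤ᵇ x≤t) (>⇒≰ᵇ t<y)

cutSplits-below : ∀ {n} {t x y : Fin n} → toℕ x ≤ toℕ t → toℕ y ≤ toℕ t → cutSplits t x y ≡ false
cutSplits-below x≤t y≤t = cutSplits-values (≤⇒≤ᵇ x≤t) (≤⇒≤ᵇ y≤t)

cutSplits-above : ∀ {n} {t x y : Fin n} → toℕ t < toℕ x → toℕ t < toℕ y → cutSplits t x y ≡ false
cutSplits-above t<x t<y = cutSplits-values (>⇒≰ᵇ t<x) (>⇒≰ᵇ t<y)

module _ {n} (π : Partition n) where

  -- Since a′ ∼ c′ and b′ ∼ e′, a chord separating a′ from b′ also separates b′
  -- from c′ and c′ from e′, so an endpoint would lie in two of the disjoint
  -- arcs (a, b], (b, c], (c, e].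
  kreweras-noncrossing : NonCrossing (kreweras π)
  kreweras-noncrossing a b c e a<b b<c c<e (ac , be , ¬ab) = ¬ab (krewerasRel-intro π λ x y xy →
    decidable-stable (cutSplits a x y ≟ᵇ cutSplits b x y) λ ne →
    let bc-ne : cutSplits b x y ≢ cutSplits c x y
        bc-ne eq = ne (trans (krewerasRel-elim π ac x y xy) (sym eq))
        ce-ne : cutSplits c x y ≢ cutSplits e x y
        ce-ne eq = ne (trans (krewerasRel-elim π ac x y xy) (trans eq (sym (krewerasRel-elim π be x y xy))))
    in cases (cuts-disagree⇒straddle x y a<b ne) (cuts-disagree⇒straddle x y b<c bc-ne) (cuts-disagree⇒straddle x y c<e ce-ne))
    where
    cases : ∀ {x y} → (Between a b x × Outside a b y) ⊎ (Between a b y × Outside a b x) →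
                      (Between b c x × Outside b c y) ⊎ (Between b c y × Outside b c x) →
                      (Between c e x × Outside c e y) ⊎ (Between c e y × Outside c e x) → ⊥
    cases (inj₁ (ab , _)) (inj₁ (bc , _)) _               = between-disjoint ≤-refl ab bc
    cases (inj₂ (ab , _)) (inj₂ (bc , _)) _               = between-disjoint ≤-refl ab bc
    cases (inj₁ (ab , _)) (inj₂ _)        (inj₁ (ce , _)) = between-disjoint (<⇒≤ b<c) ab ce
    cases (inj₁ _)        (inj₂ (bc , _)) (inj₂ (ce , _)) = between-disjoint ≤-refl bc ce
    cases (inj₂ (ab , _)) (inj₁ _)        (inj₂ (ce , _)) = between-disjoint (<⇒≤ b<c) ab ce
    cases (inj₂ _)        (inj₁ (bc , _)) (inj₁ (ce , _)) = between-disjoint ≤-refl bc ce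

  kreweras-jointNonCrossing : NonCrossing π → JointNonCrossing π (kreweras π)
  kreweras-jointNonCrossing nc (inj₁ a) (inj₁ b) (inj₁ c) (inj₁ e) a<b b<c c<e =
    nc a b c e (*-cancelˡ-< 2 _ _ a<b) (*-cancelˡ-< 2 _ _ b<c) (*-cancelˡ-< 2 _ _ c<e)
  kreweras-jointNonCrossing nc (inj₂ a) (inj₂ b) (inj₂ c) (inj₂ e) a<b b<c c<e =
    kreweras-noncrossing a b c e (suc-double<suc-double⇒< a<b) (suc-double<suc-double⇒< b<c) (suc-double<suc-double⇒< c<e)
  kreweras-jointNonCrossing nc (inj₁ a) (inj₂ b) (inj₁ c) (inj₂ e) a<b b<c c<e (ac , be , _) =
    true≢false (trans (sym (krewerasRel-elim π be a c ac)) (cutSplits-across {t = b} a≤b b<c′))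
               (cutSplits-below {t = e} (≤-trans a≤b (≤-trans (<⇒≤ b<c′) c≤e)) c≤e)
    where
    a≤b : toℕ a ≤ toℕ b
    a≤b = double<suc-double⇒≤ a<b
    b<c′ : toℕ b < toℕ c
    b<c′ = suc-double<double⇒< b<c
    c≤e : toℕ c ≤ toℕ e
    c≤e = double<suc-double⇒≤ c<e
  kreweras-jointNonCrossing nc (inj₂ a) (inj₁ b) (inj₂ c) (inj₁ e) a<b b<c c<e (ac , be , _) =
    true≢false (trans (krewerasRel-elim π ac b e be) (cutSplits-across {t = c} b≤c c<e′))
               (cutSplits-above {t = a} a<b′ (<-≤-trans a<b′ (≤-trans b≤c (<⇒≤ c<e′))))
    where
    a<b′ : toℕ a < toℕ b
    a<b′ = suc-double<double⇒< a<b
    b≤c : toℕ b ≤ toℕ c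
    b≤c = double<suc-double⇒≤ b<c
    c<e′ : toℕ c < toℕ e
    c<e′ = suc-double<double⇒< c<e
  kreweras-jointNonCrossing nc (inj₁ a) b (inj₂ c) e _ _ _ (() , _)
  kreweras-jointNonCrossing nc (inj₂ a) b (inj₁ c) e _ _ _ (() , _)
  kreweras-jointNonCrossing nc a (inj₁ b) c (inj₂ e) _ _ _ (_ , () , _)
  kreweras-jointNonCrossing nc a (inj₂ b) c (inj₁ e) _ _ _ (_ , () , _)

  kreweras-intro-< : ∀ {i j} → toℕ i < toℕ j → (∀ {x y} → x ∼[ π ] y → Between i j x → ¬ Outside i j y) →
    i ∼[ kreweras π ] j
  kreweras-intro-< i<j no-straddle = krewerasRel-intro π λ x y xy →
    cuts-agree i<j (λ (bx , oy) → no-straddle xy bx oy) (λ (by , ox) → no-straddle (symP π _ _ xy) by ox)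

  kreweras-coarsest : ∀ τ → JointNonCrossing π τ → τ ≤P kreweras π
  kreweras-coarsest τ jnc i j i∼j = by-order (<-cmp (toℕ i) (toℕ j))
    where
    no-straddle : ∀ {i j x y} → i ∼[ τ ] j → x ∼[ π ] y → Between i j x → ¬ Outside i j y
    no-straddle ij xy (between x≰i x≤j) (below y≤i) =
      jnc (inj₁ _) (inj₂ _) (inj₁ _) (inj₂ _) (≤⇒double<suc-double (≤ᵇ⇒≤ y≤i)) (<⇒suc-double<double (≰ᵇ⇒> x≰i))
          (≤⇒double<suc-double (≤ᵇ⇒≤ x≤j)) (symP π _ _ xy , ij , λ ())
    no-straddle ij xy (between x≰i x≤j) (above y≰j) =
      jnc (inj₂ _) (inj₁ _) (inj₂ _) (inj₁ _) (<⇒suc-double<double (≰ᵇ⇒> x≰i)) (≤⇒double<suc-double (≤ᵇ⇒≤ x≤j))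
          (<⇒suc-double<double (≰ᵇ⇒> y≰j)) (ij , xy , λ ())
    by-order : Tri (toℕ i < toℕ j) (toℕ i ≡ toℕ j) (toℕ j < toℕ i) → i ∼[ kreweras π ] j
    by-order (tri< i<j _ _) = kreweras-intro-< i<j (no-straddle i∼j)
    by-order (tri≈ _ i≡j _) = subst (λ k → i ∼[ kreweras π ] k) (toℕ-injective i≡j) (reflP (kreweras π) i)
    by-order (tri> _ _ j<i) = symP (kreweras π) _ _ (kreweras-intro-< j<i (no-straddle (symP τ _ _ i∼j)))

  kreweras-isKrewerasDual : NonCrossing π → IsKrewerasDual π (kreweras π)
  kreweras-isKrewerasDual nc = kreweras-jointNonCrossing nc , kreweras-coarsest

  krewerasDual-unique : NonCrossing π → ∀ τ → IsKrewerasDual π τ → τ ≈P kreweras π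
  krewerasDual-unique nc τ (jnc , coarsest) i j =
    ⇔→≡ (mk⇔ (kreweras-coarsest τ jnc i j) (coarsest (kreweras π) (kreweras-jointNonCrossing nc) i j))

kreweras-antitone : ∀ {n} {π σ : Partition n} → π ≤P σ → kreweras σ ≤P kreweras π
kreweras-antitone {π = π} {σ} π≤σ i j i∼j = krewerasRel-intro π (λ x y xy → krewerasRel-elim σ i∼j x y (π≤σ x y xy))

kreweras-cong : ∀ {n} {π ρ : Partition n} → π ≈P ρ → kreweras π ≈P kreweras ρ
kreweras-cong {π = π} {ρ} π≈ρ i j = ⇔→≡ (mk⇔
  (λ e → krewerasRel-intro ρ (λ x y xy → krewerasRel-elim π e x y (trans (π≈ρ x y) xy)))
  (λ e → krewerasRel-intro π (λ x y xy → krewerasRel-elim ρ e x y (trans (sym (π≈ρ x y)) xy))))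

cutSplits-endpoints : ∀ {n} {i j : Fin n} → toℕ i < toℕ j → cutSplits i i j ≢ cutSplits j i j
cutSplits-endpoints {i = i} {j} i<j eq =
  true≢false (trans (sym eq) (cutSplits-across {t = i} ≤-refl i<j)) (cutSplits-below {t = j} (<⇒≤ i<j) ≤-refl)

kreweras-oneBlock : ∀ {n} (ρ : Partition n) → (∀ i j → i ∼[ ρ ] j) → ∀ i j → i ∼[ kreweras ρ ] j → i ≡ j
kreweras-oneBlock ρ oneBlock i j i∼j with <-cmp (toℕ i) (toℕ j)
... | tri< i<j _ _ = ⊥-elim (cutSplits-endpoints i<j (krewerasRel-elim ρ i∼j i j (oneBlock i j)))
... | tri≈ _ i≡j _ = toℕ-injective i≡j
... | tri> _ _ j<i = ⊥-elim (cutSplits-endpoints j<i (krewerasRel-elim ρ (symP (kreweras ρ) i j i∼j) j i (oneBlock j i)))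

module _ {m} (π : Partition (suc m)) (nc : NonCrossing π) where

  private
    κ : Partition (suc m)
    κ = kreweras π

  isMin-suc⇒¬isMax-kreweras : ∀ (i : Fin m) → isMin π (suc i) ≡ true → isMax κ (inject₁ i) ≡ false
  isMin-suc⇒¬isMax-kreweras i v-min with greatest (rel π (suc i)) (reflP π (suc i))
  ... | j , v∼j , j-max = ¬-not λ u-max → true≢false u∼j (isMax-elim κ u-max j u<j)
    where
    u v : Fin (suc m)
    u = inject₁ i
    v = suc i
    u<v : toℕ u < toℕ v
    u<v = s≤s (≤-reflexive (toℕ-inject₁ i))
    v≤j : toℕ v ≤ toℕ j
    v≤j = ≮⇒≥ (λ j<v → true≢false (reflP π v) (j-max v j<v))
    u<j : toℕ u < toℕ j
    u<j = <-≤-trans u<v v≤j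
    block-of-v-inside : ∀ {y} → v ∼[ π ] y → ¬ Outside u j y
    block-of-v-inside vy (below y≤u) = true≢false vy (isMin-elim π v-min _ (≤-<-trans (≤ᵇ⇒≤ y≤u) u<v))
    block-of-v-inside vy (above y≰j) = true≢false vy (j-max _ (≰ᵇ⇒> y≰j))
    other-block-inside : ∀ {x y} → ¬ v ∼[ π ] x → x ∼[ π ] y → Between u j x → ¬ Outside u j y
    other-block-inside {x} {y} ¬vx xy (between x≰u x≤j) = λ
      { (below y≤u) → nc y v x j (≤-<-trans (≤ᵇ⇒≤ y≤u) u<v) v<x x<j
                         (symP π _ _ xy , v∼j , λ yv → ¬vx (transP π _ _ _ (symP π _ _ yv) (symP π _ _ xy)))
      ; (above y≰j) → nc v x j y v<x x<j (≰ᵇ⇒> y≰j) (v∼j , xy , ¬vx) }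
      where
      v≢x : toℕ v ≢ toℕ x
      v≢x v≡x = ¬vx (subst (λ z → v ∼[ π ] z) (toℕ-injective v≡x) (reflP π v))
      v<x : toℕ v < toℕ x
      v<x = ≤∧≢⇒< (subst (_< toℕ x) (toℕ-inject₁ i) (≰ᵇ⇒> x≰u)) v≢x
      x<j : toℕ x < toℕ j
      x<j = ≤∧≢⇒< (≤ᵇ⇒≤ x≤j) (λ x≡j → ¬vx (subst (λ z → v ∼[ π ] z) (toℕ-injective (sym x≡j)) v∼j))
    no-straddle : ∀ {x y} → x ∼[ π ] y → Between u j x → ¬ Outside u j y
    no-straddle {x} xy bx with rel π v x in vx
    ... | true  = block-of-v-inside (transP π _ _ _ vx xy)
    ... | false = other-block-inside (λ vx′ → true≢false vx′ vx) xy bx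
    u∼j : u ∼[ κ ] j
    u∼j = kreweras-intro-< π u<j no-straddle

  ¬isMin-suc⇒isMax-kreweras : ∀ (i : Fin m) → isMin π (suc i) ≡ false → isMax κ (inject₁ i) ≡ true
  ¬isMin-suc⇒isMax-kreweras i v-not-min with ¬isMin⇒smaller π v-not-min
  ... | y , y<v , v∼y = isMax-intro κ λ j u<j → ¬-not λ u∼j →
    true≢false (trans (sym (krewerasRel-elim π u∼j y (suc i) (symP π _ _ v∼y))) (cutSplits-across {t = inject₁ i} y≤u u<v))
               (cutSplits-below {t = j} (≤-trans y≤u (<⇒≤ u<j)) (subst (_< toℕ j) (toℕ-inject₁ i) u<j))
    where
    y≤u : toℕ y ≤ toℕ (inject₁ i)
    y≤u = subst (toℕ y ≤_) (sym (toℕ-inject₁ i)) (≤-pred y<v)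
    u<v : toℕ (inject₁ i) < toℕ (suc i)
    u<v = s≤s (≤-reflexive (toℕ-inject₁ i))

  isMax-kreweras-inject₁ : ∀ (i : Fin m) → isMax κ (inject₁ i) ≡ not (isMin π (suc i))
  isMax-kreweras-inject₁ i with isMin π (suc i) in e
  ... | true  = isMin-suc⇒¬isMax-kreweras i e
  ... | false = ¬isMin-suc⇒isMax-kreweras i e

isMin-zero : ∀ {m} (ρ : Partition (suc m)) → isMin ρ zero ≡ true
isMin-zero ρ = isMin-intro ρ (λ _ ())

isMax-last : ∀ {m} (ρ : Partition (suc m)) → isMax ρ (fromℕ m) ≡ true
isMax-last {m} ρ = isMax-intro ρ λ j last<j →
  contradiction (subst (_< toℕ j) (toℕ-fromℕ m) last<j) (≤⇒≯ (≤-pred (toℕ<n j)))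

-- Each block of π is counted by its minimum and each block of its Kreweras
-- complement by its maximum: 1 and n′ always are such, and for i < n exactly
-- one of "i + 1 is the minimum of its block" and "i′ is the maximum of its
-- block" holds.
#blocks+#kreweras-blocks : ∀ {m} (π : Partition m) → 0 < m → NonCrossing π →
  countTrue (isMin π) + countTrue (isMax (kreweras π)) ≡ suc m
#blocks+#kreweras-blocks {suc m} π _ nc = begin
  countTrue (isMin π) + countTrue (isMax κ)
    ≡⟨ cong₂ _+_ (countTrue-suc (isMin π)) (countTrue-last (isMax κ)) ⟩
  (𝟙 (isMin π zero) + #later-minima) + (countTrue (isMax κ ∘ inject₁) + 𝟙 (isMax κ (fromℕ m)))
    ≡⟨ cong₂ (λ a b → (𝟙 a + #later-minima) + (countTrue (isMax κ ∘ inject₁) + 𝟙 b)) (isMin-zero π) (isMax-last κ) ⟩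
  suc #later-minima + (countTrue (isMax κ ∘ inject₁) + 1)
    ≡⟨ cong (λ c → suc #later-minima + (c + 1)) (countTrue-cong (isMax-kreweras-inject₁ π nc)) ⟩
  suc #later-minima + (countTrue (not ∘ isMin π ∘ suc) + 1)
    ≡⟨ cong suc (sym (+-assoc #later-minima _ 1)) ⟩
  suc (#later-minima + countTrue (not ∘ isMin π ∘ suc) + 1)
    ≡⟨ cong (λ c → suc (c + 1)) (countTrue-complement (isMin π ∘ suc)) ⟩
  suc (m + 1)
    ≡⟨ cong suc (+-comm m 1) ⟩
  suc (suc m) ∎
  where
  open ≡-Reasoning
  κ : Partition (suc m)
  κ = kreweras π
  #later-minima : ℕ
  #later-minima = countTrue (isMin π ∘ suc)

restrict : ∀ {n m} → Partition n → (Fin m → Fin n) → Partition m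
restrict π f = record
  { rel    = λ r t → rel π (f r) (f t)
  ; reflP  = λ r → reflP π (f r)
  ; symP   = λ r t → symP π (f r) (f t)
  ; transP = λ r t u → transP π (f r) (f t) (f u)
  }

restrict-noncrossing : ∀ {n m} (π : Partition n) {f : Fin m → Fin n} →
  (∀ {r s} → toℕ r < toℕ s → toℕ (f r) < toℕ (f s)) → NonCrossing π → NonCrossing (restrict π f)
restrict-noncrossing π f-< nc a b c e a<b b<c c<e = nc _ _ _ _ (f-< a<b) (f-< b<c) (f-< c<e)

≤ᵇ-enum : ∀ {n} (p : Fin n → Bool) x r → (enum p x ≤ᵇ enum p r) ≡ (x ≤ᵇ r)
≤ᵇ-enum p x r = ⇔→≡ (mk⇔ (≤⇒≤ᵇ ∘ enum-≤-reflect p ∘ ≤ᵇ⇒≤) (≤⇒≤ᵇ ∘ enum-≤ p ∘ ≤ᵇ⇒≤))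

cutSplits-enum : ∀ {n} (p : Fin n → Bool) r x y → cutSplits (enum p r) (enum p x) (enum p y) ≡ cutSplits r x y
cutSplits-enum p r x y = cong₂ _xor_ (≤ᵇ-enum p x r) (≤ᵇ-enum p y r)

noncrossing-cuts-agree : ∀ {n} {σ : Partition n} → NonCrossing σ → ∀ {i j x y} →
  i ∼[ σ ] j → x ∼[ σ ] y → ¬ i ∼[ σ ] x → cutSplits i x y ≡ cutSplits j x y
noncrossing-cuts-agree {σ = σ} nc {i} {j} {x} {y} ij xy ¬ix = by-order (<-cmp (toℕ i) (toℕ j))
  where
  no-straddle : ∀ {i j x y} → toℕ i < toℕ j → i ∼[ σ ] j → x ∼[ σ ] y → ¬ i ∼[ σ ] x → ¬ (Between i j x × Outside i j y)
  no-straddle {i} {j} {x} {y} i<j ij xy ¬ix (between x≰i x≤j , out) = crossing out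
    where
    x<j : toℕ x < toℕ j
    x<j = ≤∧≢⇒< (≤ᵇ⇒≤ x≤j) (λ x≡j → ¬ix (subst (λ z → i ∼[ σ ] z) (toℕ-injective (sym x≡j)) ij))
    y≢i : toℕ y ≢ toℕ i
    y≢i y≡i = ¬ix (subst (λ z → z ∼[ σ ] x) (toℕ-injective y≡i) (symP σ _ _ xy))
    crossing : ¬ Outside i j y
    crossing (below y≤i) = nc y i x j (≤∧≢⇒< (≤ᵇ⇒≤ y≤i) y≢i) (≰ᵇ⇒> x≰i) x<j
      (symP σ _ _ xy , ij , λ yi → ¬ix (transP σ _ _ _ (symP σ _ _ yi) (symP σ _ _ xy)))
    crossing (above y≰j) = nc i x j y (≰ᵇ⇒> x≰i) x<j (≰ᵇ⇒> y≰j) (ij , xy , ¬ix)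
  agree-< : ∀ {i j} → toℕ i < toℕ j → i ∼[ σ ] j → ¬ i ∼[ σ ] x → cutSplits i x y ≡ cutSplits j x y
  agree-< i<j ij ¬ix = cuts-agree i<j (no-straddle i<j ij xy ¬ix)
    (no-straddle i<j ij (symP σ _ _ xy) (λ iy → ¬ix (transP σ _ _ _ iy (symP σ _ _ xy))))
  by-order : Tri (toℕ i < toℕ j) (toℕ i ≡ toℕ j) (toℕ j < toℕ i) → cutSplits i x y ≡ cutSplits j x y
  by-order (tri< i<j _ _) = agree-< i<j ij ¬ix
  by-order (tri≈ _ i≡j _) = cong (λ t → cutSplits t x y) (toℕ-injective i≡j)
  by-order (tri> _ _ j<i) = sym (agree-< j<i (symP σ _ _ ij) (λ jx → ¬ix (transP σ _ _ _ ij jx)))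

module BlockDecomposition {n k} {σ : Partition n} (σ-nc : NonCrossing σ) {ℓ : Fin n → Fin k}
  (labelling : BlockLabelling k σ ℓ) where

  private
    ℓ-sound : ∀ i j → i ∼[ σ ] j → ℓ i ≡ ℓ j
    ℓ-sound = proj₁ labelling
    ℓ-complete : ∀ i j → ℓ i ≡ ℓ j → i ∼[ σ ] j
    ℓ-complete = proj₁ (proj₂ labelling)

  inBlock : Fin k → Fin n → Bool
  inBlock b i = ⌊ ℓ i ≟ b ⌋

  inBlock-intro : ∀ {b i} → ℓ i ≡ b → inBlock b i ≡ true
  inBlock-intro {b} {i} = ⇒isYes (ℓ i ≟ b)

  elem : ∀ b → Fin (labelSize ℓ b) → Fin n
  elem b = enum (inBlock b)

  ℓ-elem : ∀ b r → ℓ (elem b r) ≡ b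
  ℓ-elem b r = isYes⇒ (ℓ (elem b r) ≟ b) (enum-sat (inBlock b) r)

  index : ∀ b i → ℓ i ≡ b → Fin (labelSize ℓ b)
  index b i e = rank (inBlock b) i (inBlock-intro e)

  elem-index : ∀ b i (e : ℓ i ≡ b) → elem b (index b i e) ≡ i
  elem-index b i e = enum-rank (inBlock b) i (inBlock-intro e)

  index-elem : ∀ b r → index b (elem b r) (ℓ-elem b r) ≡ r
  index-elem b r = rank-enum (inBlock b) r _

  elem-same-block : ∀ b r t → elem b r ∼[ σ ] elem b t
  elem-same-block b r t = ℓ-complete _ _ (trans (ℓ-elem b r) (sym (ℓ-elem b t)))

  infixl 30 _↾_

  _↾_ : Partition n → ∀ b → Partition (labelSize ℓ b)
  π ↾ b = restrict π (elem b)

  ↾-index : ∀ π b {i j} (ei : ℓ i ≡ b) (ej : ℓ j ≡ b) → rel π i j ≡ rel (π ↾ b) (index b i ei) (index b j ej)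
  ↾-index π b {i} {j} ei ej = sym (cong₂ (rel π) (elem-index b i ei) (elem-index b j ej))

  ↾-noncrossing : ∀ π → NonCrossing π → ∀ b → NonCrossing (π ↾ b)
  ↾-noncrossing π nc b = restrict-noncrossing π (enum-< (inBlock b)) nc

  LabelPreserving : Partition n → Set
  LabelPreserving π = ∀ i j → i ∼[ π ] j → ℓ i ≡ ℓ j

  ≤σ⇒labelPreserving : ∀ {π} → π ≤P σ → LabelPreserving π
  ≤σ⇒labelPreserving π≤σ i j i∼j = ℓ-sound i j (π≤σ i j i∼j)

  labelPreserving⇒≤σ : ∀ {π} → LabelPreserving π → π ≤P σ
  labelPreserving⇒≤σ preserving i j i∼j = ℓ-complete i j (preserving i j i∼j)

  countTrue-by-block : ∀ (q : Fin n → Bool) → countTrue q ≡ ∑[ b < k ] countTrue (q ∘ elem b)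
  countTrue-by-block q = trans (countTrue-fibres ℓ q) (sum-cong-≗ (λ b → sym (countTrue-∘enum (inBlock b) q)))

  module _ (π : Partition n) (preserving : LabelPreserving π) (b : Fin k) where

    private
      inBlock-of-related : ∀ r {j} → elem b r ∼[ π ] j → inBlock b j ≡ true
      inBlock-of-related r rj = inBlock-intro (trans (sym (preserving _ _ rj)) (ℓ-elem b r))

      related-elem : ∀ r {j} → elem b r ∼[ π ] j → ∃ λ t → elem b t ≡ j
      related-elem r {j} rj = index b j ℓj≡b , elem-index b j ℓj≡b
        where
        ℓj≡b : ℓ j ≡ b
        ℓj≡b = trans (sym (preserving _ _ rj)) (ℓ-elem b r)

    blockSize-↾ : ∀ r → blockSize (π ↾ b) r ≡ blockSize π (elem b r)
    blockSize-↾ r = trans (countTrue-∘enum (inBlock b) (rel π (elem b r)))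
      (countTrue-cong (λ j → ∧-by-implication (rel π (elem b r) j) (inBlock b j) (inBlock-of-related r)))

    isMin-↾ : ∀ r → isMin (π ↾ b) r ≡ isMin π (elem b r)
    isMin-↾ r = ⇔→≡ (mk⇔ (λ min → isMin-intro π (λ j j<r → ¬-not λ rj → no-smaller min (related-elem r rj) rj j<r))
                         (λ min → isMin-intro (π ↾ b) λ t t<r → isMin-elim π min (elem b t) (enum-< (inBlock b) t<r)))
      where
      no-smaller : isMin (π ↾ b) r ≡ true → ∀ {j} → (∃ λ t → elem b t ≡ j) →
              elem b r ∼[ π ] j → toℕ j < toℕ (elem b r) → ⊥
      no-smaller min (t , refl) rt t<r = true≢false rt (isMin-elim (π ↾ b) min t (enum-<-reflect (inBlock b) t<r))

    isMax-↾ : ∀ r → isMax (π ↾ b) r ≡ isMax π (elem b r)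
    isMax-↾ r = ⇔→≡ (mk⇔ (λ max → isMax-intro π (λ j r<j → ¬-not λ rj → no-larger max (related-elem r rj) rj r<j))
                         (λ max → isMax-intro (π ↾ b) λ t r<t → isMax-elim π max (elem b t) (enum-< (inBlock b) r<t)))
      where
      no-larger : isMax (π ↾ b) r ≡ true → ∀ {j} → (∃ λ t → elem b t ≡ j) →
              elem b r ∼[ π ] j → toℕ (elem b r) < toℕ j → ⊥
      no-larger max (t , refl) rt r<t = true≢false rt (isMax-elim (π ↾ b) max t (enum-<-reflect (inBlock b) r<t))

    kreweras-↾ : ∀ r t → rel (kreweras π) (elem b r) (elem b t) ≡ rel (kreweras (π ↾ b)) r t
    kreweras-↾ r t = ⇔→≡ (mk⇔ to from)
      where
      to : elem b r ∼[ kreweras π ] elem b t → r ∼[ kreweras (π ↾ b) ] t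
      to rt = krewerasRel-intro (π ↾ b) λ x y xy →
        trans (sym (cutSplits-enum (inBlock b) r x y))
              (trans (krewerasRel-elim π rt _ _ xy) (cutSplits-enum (inBlock b) t x y))
      chord : r ∼[ kreweras (π ↾ b) ] t → ∀ x y → x ∼[ π ] y → Dec (ℓ x ≡ b) →
              cutSplits (elem b r) x y ≡ cutSplits (elem b t) x y
      chord rt x y xy (no ℓx≢b) =
        noncrossing-cuts-agree {σ = σ} σ-nc (elem-same-block b r t) (labelPreserving⇒≤σ {π} preserving x y xy)
          (λ rx → ℓx≢b (trans (sym (ℓ-sound _ _ rx)) (ℓ-elem b r)))
      chord rt x y xy (yes ℓx≡b) =
        subst₂ (λ x′ y′ → cutSplits (elem b r) x′ y′ ≡ cutSplits (elem b t) x′ y′)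
          (elem-index b x ℓx≡b) (elem-index b y ℓy≡b)
          (trans (cutSplits-enum (inBlock b) r _ _)
            (trans (krewerasRel-elim (π ↾ b) rt _ _ (trans (sym (↾-index π b ℓx≡b ℓy≡b)) xy))
              (sym (cutSplits-enum (inBlock b) t _ _))))
        where
        ℓy≡b : ℓ y ≡ b
        ℓy≡b = trans (sym (preserving x y xy)) ℓx≡b
      from : r ∼[ kreweras (π ↾ b) ] t → elem b r ∼[ kreweras π ] elem b t
      from rt = krewerasRel-intro π λ x y xy → chord rt x y xy (ℓ x ≟ b)

  kreweras-σ-transversal : ∀ {i j} → i ∼[ kreweras σ ] j → ℓ i ≡ ℓ j → i ≡ j
  kreweras-σ-transversal {i} {j} i∼j ℓi≡ℓj =
    trans (sym (elem-index b i refl)) (trans (cong (elem b) indices-equal) (elem-index b j (sym ℓi≡ℓj)))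
    where
    b = ℓ i
    indices-equal : index b i refl ≡ index b j (sym ℓi≡ℓj)
    indices-equal = kreweras-oneBlock (σ ↾ b) (elem-same-block b) _ _
      (trans (sym (kreweras-↾ σ ℓ-sound b _ _))
        (subst₂ (λ u v → u ∼[ kreweras σ ] v) (sym (elem-index b i refl)) (sym (elem-index b j (sym ℓi≡ℓj))) i∼j))

  blockSize-σ : ∀ i → blockSize σ i ≡ labelSize ℓ (ℓ i)
  blockSize-σ i = countTrue-cong λ j → ⇔→≡ (mk⇔ (λ i∼j → inBlock-intro (sym (ℓ-sound i j i∼j)))
                                                (λ j∈ → ℓ-complete i j (sym (isYes⇒ (ℓ j ≟ ℓ i) j∈))))

  ↾-reflects-≤ : ∀ {π ρ} → LabelPreserving π → (∀ b → π ↾ b ≤P ρ ↾ b) → π ≤P ρ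
  ↾-reflects-≤ {π} {ρ} preserving π↾≤ρ↾ i j i∼j =
    trans (↾-index ρ b refl ℓj≡b) (π↾≤ρ↾ b _ _ (trans (sym (↾-index π b refl ℓj≡b)) i∼j))
    where
    b = ℓ i
    ℓj≡b : ℓ j ≡ b
    ℓj≡b = sym (preserving i j i∼j)

  noncrossing-from-pieces : ∀ {π} → LabelPreserving π → (∀ b → NonCrossing (π ↾ b)) → NonCrossing π
  noncrossing-from-pieces {π} preserving pieces a b c e a<b b<c c<e (ac , be , ¬ab) = by-cases (ℓ b ≟ ℓ a)
    where
    β = ℓ a
    by-cases : Dec (ℓ b ≡ β) → ⊥
    by-cases (no ℓb≢β) = σ-nc a b c e a<b b<c c<e
      (labelPreserving⇒≤σ {π} preserving a c ac , labelPreserving⇒≤σ {π} preserving b e be ,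
       λ a∼σb → ℓb≢β (sym (ℓ-sound a b a∼σb)))
    by-cases (yes ℓb≡β) = pieces β (index β a refl) (index β b ℓb≡β) (index β c ℓc≡β) (index β e ℓe≡β)
      (index-< a<b) (index-< b<c) (index-< c<e)
      (trans (sym (↾-index π β refl ℓc≡β)) ac , trans (sym (↾-index π β ℓb≡β ℓe≡β)) be ,
       λ ab → ¬ab (trans (↾-index π β refl ℓb≡β) ab))
      where
      ℓc≡β : ℓ c ≡ β
      ℓc≡β = sym (preserving a c ac)
      ℓe≡β : ℓ e ≡ β
      ℓe≡β = trans (sym (preserving b e be)) ℓb≡β
      index-< : ∀ {x y} {ex : ℓ x ≡ β} {ey : ℓ y ≡ β} → toℕ x < toℕ y → toℕ (index β x ex) < toℕ (index β y ey)
      index-< {x} {y} {ex} {ey} x<y = enum-<-reflect (inBlock β)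
        (subst₂ (λ u v → toℕ u < toℕ v) (sym (elem-index β x ex)) (sym (elem-index β y ey)) x<y)

-- Modulo d, m ≡ #blocks ρ (all blocks have size ≡ 1) and m − |block of r| ≡
-- #blocks (kreweras ρ) − 1 (the other blocks); Euler's relation
-- #blocks ρ + #blocks (kreweras ρ) = m + 1 then forces |block of r| ≡ 1.
kreweras-block≡1-mod : ∀ {d m} (ρ : Partition m) → 0 < m → NonCrossing ρ → m ≡ 1 [mod d ] →
  (∀ i → blockSize ρ i ≡ 1 [mod d ]) → ∀ r →
  (∀ t → ¬ r ∼[ kreweras ρ ] t → blockSize (kreweras ρ) t ≡ 1 [mod d ]) →
  blockSize (kreweras ρ) r ≡ 1 [mod d ]
kreweras-block≡1-mod {d} {m} ρ m>0 nc m≡1 ρ-blocks r other-blocks =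
  mod-trans (+-cancelˡ-mod C C+X≡C+Mi) (mod-trans (mod-sym m≡Mi) m≡1)
  where
  open SetoidReasoning (mod-setoid d)
  κ : Partition m
  κ = kreweras ρ
  S : Fin m → Bool
  S t = not (rel κ r t)
  X R C Mi : ℕ
  X = blockSize κ r
  R = countTrue (λ t → isMax κ t ∧ S t)
  C = countTrue (isMax κ)
  Mi = countTrue (isMin ρ)
  S-saturated : Saturated κ S
  S-saturated {t} {u} St tu = cong not (¬-not λ ru →
    true≢false (transP κ _ _ _ ru (symP κ _ _ tu)) (not-injective St))
  |S|≡R : countTrue S ≡ R [mod d ]
  |S|≡R = saturated-size≡#representatives (isMax-representatives κ) S S-saturated
    (λ t St → other-blocks t (λ rt → true≢false rt (not-injective St)))
  C≡1+R : C ≡ 1 + R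
  C≡1+R = trans (countTrue-split (isMax κ) (rel κ r))
                (cong (_+ R) (countTrue-representatives-block (isMax-representatives κ) r))
  m≡Mi : m ≡ Mi [mod d ]
  m≡Mi = begin
    m                                    ≡⟨ countTrue-true ⟨
    countTrue {m} (λ _ → true)
      ≈⟨ saturated-size≡#representatives (isMin-representatives ρ) (λ _ → true) (λ _ _ → refl) (λ i _ → ρ-blocks i) ⟩
    countTrue (λ i → isMin ρ i ∧ true)   ≡⟨ countTrue-cong (λ i → ∧-identityʳ (isMin ρ i)) ⟩
    Mi                                   ∎
  C+X≡C+Mi : C + X ≡ C + Mi [mod d ]
  C+X≡C+Mi = begin
    C + X                  ≡⟨ cong (_+ X) C≡1+R ⟩
    1 + R + X              ≈⟨ +-cong-mod (+-cong-mod (mod-refl {a = 1}) (mod-sym |S|≡R)) mod-refl ⟩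
    1 + countTrue S + X    ≡⟨ cong suc (+-comm (countTrue S) X) ⟩
    1 + (X + countTrue S)  ≡⟨ cong suc (countTrue-complement (rel κ r)) ⟩
    suc m                  ≡⟨ #blocks+#kreweras-blocks ρ m>0 nc ⟨
    Mi + C                 ≡⟨ +-comm Mi C ⟩
    C + Mi                 ∎

module _ {d m : ℕ} where

  blocksOneModD⇒≡1 : ∀ {ρ : Partition m} → BlocksOneModD d ρ → ∀ i → blockSize ρ i ≡ 1 [mod d ]
  blocksOneModD⇒≡1 {ρ} blocks i = ∣∸1⇒≡1-mod (blockSize-pos ρ i) (blocks i)

  ≡1⇒blocksOneModD : ∀ {ρ : Partition m} → (∀ i → blockSize ρ i ≡ 1 [mod d ]) → BlocksOneModD d ρ
  ≡1⇒blocksOneModD {ρ} blocks i = ≡1-mod⇒∣∸1 (blockSize-pos ρ i) (blocks i)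

module _ {d m : ℕ} {ρ : Partition m} where

  inNC-kreweras : InNC d ρ → ∀ i → blockSize (kreweras ρ) i ≡ 1 [mod d ]
  inNC-kreweras (nc , _ , duals) = blocksOneModD⇒≡1 {ρ = kreweras ρ} (duals (kreweras ρ) (kreweras-isKrewerasDual ρ nc))

  inNC-blocks : InNC d ρ → ∀ i → blockSize ρ i ≡ 1 [mod d ]
  inNC-blocks (_ , blocks , _) = blocksOneModD⇒≡1 {ρ = ρ} blocks

  inNC : NonCrossing ρ → (∀ i → blockSize ρ i ≡ 1 [mod d ]) → (∀ i → blockSize (kreweras ρ) i ≡ 1 [mod d ]) → InNC d ρ
  inNC nc blocks kreweras-blocks = nc , ≡1⇒blocksOneModD {ρ = ρ} blocks , λ τ dual →
    ≡1⇒blocksOneModD {ρ = τ} λ i →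
      mod-trans (mod-reflexive (blockSize-cong {ρ = τ} {kreweras ρ} (krewerasDual-unique ρ nc τ dual) i)) (kreweras-blocks i)

inNC-cong : ∀ {d m} {ρ ρ′ : Partition m} → ρ ≈P ρ′ → InNC d ρ → InNC d ρ′
inNC-cong {ρ = ρ} {ρ′} ρ≈ρ′ ρ∈NC@(nc , _ , _) = inNC (noncrossing-cong {ρ = ρ} {ρ′} ρ≈ρ′ nc)
  (λ i → mod-trans (mod-reflexive (sym (blockSize-cong {ρ = ρ} {ρ′} ρ≈ρ′ i))) (inNC-blocks ρ∈NC i))
  (λ i → mod-trans (mod-reflexive (sym (blockSize-cong {ρ = kreweras ρ} {kreweras ρ′} (kreweras-cong {π = ρ} {ρ′} ρ≈ρ′) i)))
                   (inNC-kreweras ρ∈NC i))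

∑-const-1 : ∀ k → ∑[ b < k ] 1 ≡ k
∑-const-1 zero    = refl
∑-const-1 (suc k) = cong suc (∑-const-1 k)

module KrewerasBelow {d n} {σ : Partition n} (σ-nc : NonCrossing σ) {ℓ : Fin n → Fin (suc d)}
  (labelling : BlockLabelling (suc d) σ ℓ) where

  open BlockDecomposition {σ = σ} σ-nc labelling public

  private
    ℓ-onto : ∀ b → ∃ λ i → ℓ i ≡ b
    ℓ-onto = proj₂ (proj₂ labelling)

  size>0 : ∀ b → 0 < labelSize ℓ b
  size>0 b = countTrue-pos (inBlock b) (inBlock-intro (proj₂ (ℓ-onto b)))

  n>0 : 0 < n
  n>0 = ≤-<-trans z≤n (toℕ<n (proj₁ (ℓ-onto zero)))

  n≡∑sizes : n ≡ ∑[ b < suc d ] labelSize ℓ b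
  n≡∑sizes = trans (sym (countTrue-true {n}))
    (trans (countTrue-by-block (λ _ → true)) (sum-cong-≗ (λ b → countTrue-true {labelSize ℓ b})))

  module _ (π : Partition n) (π-nc : NonCrossing π) (π≤σ : π ≤P σ) where

    private
      κ μ : Partition n
      κ = kreweras π
      μ = κ ⊓ σ
      preserving : LabelPreserving π
      preserving = ≤σ⇒labelPreserving {π} π≤σ

    μ-preserving : LabelPreserving (kreweras π ⊓ σ)
    μ-preserving = ≤σ⇒labelPreserving {kreweras π ⊓ σ} (λ _ _ → ⊓-elimʳ (kreweras π) σ)

    ⊓σ-↾ : ∀ b → (kreweras π ⊓ σ) ↾ b ≈P kreweras (π ↾ b)
    ⊓σ-↾ b r t = trans (cong₂ _∧_ (kreweras-↾ π preserving b r t) (elem-same-block b r t)) (∧-identityʳ _)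

    #minima-by-block : countTrue (isMin π) ≡ ∑[ b < suc d ] countTrue (isMin (π ↾ b))
    #minima-by-block = trans (countTrue-by-block (isMin π))
      (sum-cong-≗ λ b → countTrue-cong λ r → sym (isMin-↾ π preserving b r))

    #⊓σ-maxima-by-block : countTrue (isMax (kreweras π ⊓ σ)) ≡ ∑[ b < suc d ] countTrue (isMax (kreweras (π ↾ b)))
    #⊓σ-maxima-by-block = trans (countTrue-by-block (isMax μ))
      (sum-cong-≗ λ b → countTrue-cong λ r →
        trans (sym (isMax-↾ μ μ-preserving b r)) (isMax-cong {ρ = μ ↾ b} {kreweras (π ↾ b)} (⊓σ-↾ b) r))

    #minima+#⊓σ-maxima : countTrue (isMin π) + countTrue (isMax (kreweras π ⊓ σ)) ≡ suc d + n
    #minima+#⊓σ-maxima = begin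
      countTrue (isMin π) + countTrue (isMax μ)
        ≡⟨ cong₂ _+_ #minima-by-block #⊓σ-maxima-by-block ⟩
      ∑[ b < suc d ] countTrue (isMin (π ↾ b)) + ∑[ b < suc d ] countTrue (isMax (kreweras (π ↾ b)))
        ≡⟨ ∑-distrib-+ (λ b → countTrue (isMin (π ↾ b))) (λ b → countTrue (isMax (kreweras (π ↾ b)))) ⟨
      ∑[ b < suc d ] (countTrue (isMin (π ↾ b)) + countTrue (isMax (kreweras (π ↾ b))))
        ≡⟨ sum-cong-≗ (λ b → #blocks+#kreweras-blocks (π ↾ b) (size>0 b) (↾-noncrossing π π-nc b)) ⟩
      ∑[ b < suc d ] (1 + labelSize ℓ b)
        ≡⟨ ∑-distrib-+ (λ _ → 1) (labelSize ℓ) ⟩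
      ∑[ b < suc d ] 1 + ∑[ b < suc d ] labelSize ℓ b
        ≡⟨ cong₂ _+_ (∑-const-1 (suc d)) (sym n≡∑sizes) ⟩
      suc d + n ∎
      where open ≡-Reasoning

    extra : Fin n → Bool
    extra i = isMax (kreweras π ⊓ σ) i ∧ not (isMax (kreweras π) i)

    #extra≡d : countTrue extra ≡ d
    #extra≡d = +-cancelˡ-≡ (countTrue (isMin π) + countTrue (isMax κ)) _ _ (begin
      countTrue (isMin π) + countTrue (isMax κ) + countTrue extra
        ≡⟨ +-assoc (countTrue (isMin π)) _ _ ⟩
      countTrue (isMin π) + (countTrue (isMax κ) + countTrue extra)
        ≡⟨ cong (λ c → countTrue (isMin π) + (c + countTrue extra)) (countTrue-cong κ-max⇒μ-max) ⟨
      countTrue (isMin π) + (countTrue (λ i → isMax μ i ∧ isMax κ i) + countTrue extra)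
        ≡⟨ cong (countTrue (isMin π) +_) (countTrue-split (isMax μ) (isMax κ)) ⟨
      countTrue (isMin π) + countTrue (isMax μ)
        ≡⟨ #minima+#⊓σ-maxima ⟩
      suc d + n
        ≡⟨ cong suc (+-comm d n) ⟩
      suc n + d
        ≡⟨ cong (_+ d) (#blocks+#kreweras-blocks π n>0 π-nc) ⟨
      countTrue (isMin π) + countTrue (isMax κ) + d ∎)
      where
      open ≡-Reasoning
      κ-max⇒μ-max : ∀ i → isMax μ i ∧ isMax κ i ≡ isMax κ i
      κ-max⇒μ-max i = ∧-by-implication (isMax κ i) (isMax μ i)
        (λ max → isMax-intro μ (λ j i<j → cong (_∧ rel σ i j) (isMax-elim κ max j i<j)))

  σ-extra-exists : 1 ≤ d → ∃ λ z → extra σ σ-nc (λ _ _ i∼j → i∼j) z ≡ true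
  σ-extra-exists d≥1 = countTrue-witness (extra σ σ-nc (λ _ _ i∼j → i∼j))
    (subst (0 <_) (sym (#extra≡d σ σ-nc (λ _ _ i∼j → i∼j))) d≥1)

  module _ (σ-kreweras-blocks : BlocksOneModD d (kreweras σ)) {z : Fin n}
    (z-extra : extra σ σ-nc (λ _ _ i∼j → i∼j) z ≡ true) where

    private
      κσ : Partition n
      κσ = kreweras σ

    extra-not-isMax : isMax κσ z ≡ false
    extra-not-isMax = not-injective (∧-conicalʳ (isMax (κσ ⊓ σ) z) (not (isMax κσ z)) z-extra)

    extra-blockSize : suc d ≤ blockSize κσ z
    extra-blockSize = at-least-suc-d (blockSize κσ z) at-least-2 (σ-kreweras-blocks z)
      where
      at-least-2 : 2 ≤ blockSize κσ z
      at-least-2 with ¬isMax⇒larger κσ extra-not-isMax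
      ... | j , z<j , z∼j = countTrue-≤-injection {p = λ (_ : Fin 2) → true} {q = rel κσ z} pick
            (λ { zero _ → reflP κσ z ; (suc zero) _ → z∼j })
            (λ { zero zero _ _ _ → refl ; (suc zero) (suc zero) _ _ _ → refl
               ; zero (suc zero) _ _ z≡j → contradiction (cong toℕ z≡j) (<⇒≢ z<j)
               ; (suc zero) zero _ _ j≡z → contradiction (cong toℕ (sym j≡z)) (<⇒≢ z<j) })
        where
        pick : Fin 2 → Fin n
        pick zero = z
        pick (suc zero) = j
      at-least-suc-d : ∀ s → 2 ≤ s → d ∣ s ∸ 1 → suc d ≤ s
      at-least-suc-d (suc (suc s)) _         d∣s+1 = s≤s (∣⇒≤ d∣s+1)
      at-least-suc-d (suc zero)    (s≤s ()) _

    extra-meets-every-block : ∀ b → ∃ λ w → z ∼[ κσ ] w × ℓ w ≡ b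
    extra-meets-every-block b with any? (λ w → (rel κσ z w ≟ᵇ true) ×-dec (ℓ w ≟ b))
    ... | yes found = found
    ... | no none = contradiction (≤-trans extra-blockSize (≤-trans block≤others (≤-reflexive #others≡d))) (<-irrefl refl)
      where
      others : Fin (suc d) → Bool
      others c = not ⌊ c ≟ b ⌋
      #others≡d : countTrue others ≡ d
      #others≡d = +-cancelˡ-≡ 1 _ _
        (trans (cong (_+ countTrue others) (sym (countTrue-≟ b))) (countTrue-complement (λ c → ⌊ c ≟ b ⌋)))
      block≤others : blockSize κσ z ≤ countTrue others
      block≤others = countTrue-≤-injection {p = rel κσ z} {q = others} ℓ
        (λ w z∼w → cong not (⇒isNo (ℓ w ≟ b) (λ ℓw≡b → none (w , z∼w , ℓw≡b))))
        (λ w w′ z∼w z∼w′ → kreweras-σ-transversal (transP κσ _ _ _ (symP κσ _ _ z∼w) z∼w′))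

  module AroundHub (z : Fin n) (w : Fin (suc d) → Fin n)
    (z∼w : ∀ b → z ∼[ kreweras σ ] w b) (ℓ-w : ∀ b → ℓ (w b) ≡ b)
    (π : Partition n) (π-nc : NonCrossing π) (π≤σ : π ≤P σ) where

    private
      κ μ : Partition n
      κ = kreweras π
      μ = κ ⊓ σ
      preserving : LabelPreserving π
      preserving = ≤σ⇒labelPreserving {π} π≤σ
      module μ-Tops = Representatives (isMax-representatives μ)
      module κ-Tops = Representatives (isMax-representatives κ)

      z∼κw : ∀ b → z ∼[ κ ] w b
      z∼κw b = kreweras-antitone {π = π} {σ} π≤σ z (w b) (z∼w b)

      near-top : Fin n → Bool
      near-top i = isMax μ i ∧ rel κ z i

      top-of : Fin (suc d) → Fin n
      top-of b = proj₁ (μ-Tops.represent (w b))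

      ℓ-top-of : ∀ b → ℓ (top-of b) ≡ b
      ℓ-top-of b = trans (sym (μ-preserving π π-nc π≤σ _ _ (proj₂ (proj₂ (μ-Tops.represent (w b)))))) (ℓ-w b)

      #near-tops : suc d ≤ countTrue near-top
      #near-tops = ≤-trans (≤-reflexive (sym (countTrue-true {suc d})))
        (countTrue-≤-injection {p = λ _ → true} {q = near-top} top-of
          (λ b _ → let (u , max-u , w∼u) = μ-Tops.represent (w b) in
                   ∧-intro max-u (transP κ _ _ _ (z∼κw b) (⊓-elimˡ κ σ w∼u)))
          (λ b b′ _ _ eq → trans (sym (ℓ-top-of b)) (trans (cong ℓ eq) (ℓ-top-of b′))))

      near-κ-top⇒ : ∀ {i} → near-top i ∧ isMax κ i ≡ true → isMax κ i ≡ true × z ∼[ κ ] i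
      near-κ-top⇒ {i} e = ∧-conicalʳ (near-top i) (isMax κ i) e ,
        ∧-conicalʳ (isMax μ i) (rel κ z i) (∧-conicalˡ (near-top i) (isMax κ i) e)

      #near-κ-tops≤1 : countTrue (λ i → near-top i ∧ isMax κ i) ≤ 1
      #near-κ-tops≤1 = countTrue-≤1 (λ i → near-top i ∧ isMax κ i) λ i j ei ej →
        let (max-i , z∼i) = near-κ-top⇒ ei ; (max-j , z∼j) = near-κ-top⇒ ej in
        κ-Tops.unique max-i max-j (transP κ i z j (symP κ z i z∼i) z∼j)

      extra′ : Fin n → Bool
      extra′ = extra π π-nc π≤σ

      #near-extras : d ≤ countTrue (λ i → extra′ i ∧ rel κ z i)
      #near-extras = +-cancelˡ-≤ 1 _ _ (begin
        suc d
          ≤⟨ #near-tops ⟩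
        countTrue near-top
          ≡⟨ countTrue-split near-top (isMax κ) ⟩
        countTrue (λ i → near-top i ∧ isMax κ i) + countTrue (λ i → near-top i ∧ not (isMax κ i))
          ≤⟨ +-monoˡ-≤ _ #near-κ-tops≤1 ⟩
        1 + countTrue (λ i → near-top i ∧ not (isMax κ i))
          ≡⟨ cong (1 +_) (countTrue-cong λ i → ∧-swapʳ (isMax μ i) (rel κ z i) _) ⟩
        1 + countTrue (λ i → extra′ i ∧ rel κ z i) ∎)
        where open ≤-Reasoning

      #far-extras≡0 : countTrue (λ i → extra′ i ∧ not (rel κ z i)) ≡ 0
      #far-extras≡0 = n≤0⇒n≡0 (+-cancelˡ-≤ d _ _ (begin
        d + countTrue (λ i → extra′ i ∧ not (rel κ z i))
          ≤⟨ +-monoˡ-≤ _ #near-extras ⟩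
        countTrue (λ i → extra′ i ∧ rel κ z i) + countTrue (λ i → extra′ i ∧ not (rel κ z i))
          ≡⟨ countTrue-split extra′ (rel κ z) ⟨
        countTrue extra′
          ≡⟨ #extra≡d π π-nc π≤σ ⟩
        d
          ≡⟨ +-identityʳ d ⟨
        d + 0 ∎))
        where open ≤-Reasoning

    -- The block of z in kreweras π contains the tops of the d + 1 blocks of
    -- kreweras π ⊓ σ through the w b, at most one of which is a top of
    -- kreweras π; so all d extra tops lie in that block.
    extra-near-hub : ∀ {i} → extra π π-nc π≤σ i ≡ true → z ∼[ kreweras π ] i
    extra-near-hub extra-i = ¬-not λ far →
      <⇒≢ (countTrue-pos (λ i → extra′ i ∧ not (rel κ z i)) (∧-intro extra-i (cong not far))) (sym #far-extras≡0)

    far-isMax : ∀ {i} → ¬ z ∼[ kreweras π ] i → isMax (kreweras π ⊓ σ) i ≡ true → isMax (kreweras π) i ≡ true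
    far-isMax far max = ¬-not λ not-max → far (extra-near-hub (∧-intro max (cong not not-max)))

    far-labelPreserving : ∀ {i j} → ¬ z ∼[ kreweras π ] i → i ∼[ kreweras π ] j → ℓ i ≡ ℓ j
    far-labelPreserving {i} {j} far i∼j =
      trans (μ-preserving π π-nc π≤σ i u i∼u) (trans (cong ℓ u≡v) (sym (μ-preserving π π-nc π≤σ j v j∼v)))
      where
      u v : Fin n
      u = proj₁ (μ-Tops.represent i)
      v = proj₁ (μ-Tops.represent j)
      i∼u : i ∼[ μ ] u
      i∼u = proj₂ (proj₂ (μ-Tops.represent i))
      j∼v : j ∼[ μ ] v
      j∼v = proj₂ (proj₂ (μ-Tops.represent j))
      i∼κu : i ∼[ κ ] u
      i∼κu = ⊓-elimˡ κ σ i∼u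
      j∼κv : j ∼[ κ ] v
      j∼κv = ⊓-elimˡ κ σ j∼v
      u∼κv : u ∼[ κ ] v
      u∼κv = transP κ u i v (symP κ i u i∼κu) (transP κ i j v i∼j j∼κv)
      u≡v : u ≡ v
      u≡v = κ-Tops.unique
        (far-isMax (λ z∼u → far (transP κ z u i z∼u (symP κ i u i∼κu))) (proj₁ (proj₂ (μ-Tops.represent i))))
        (far-isMax (λ z∼v → far (transP κ z v i z∼v (transP κ v u i (symP κ u v u∼κv) (symP κ i u i∼κu))))
                   (proj₁ (proj₂ (μ-Tops.represent j))))
        u∼κv

    private
      kreweras-↾-index : ∀ {b x} (e : ℓ x ≡ b) r → rel κ x (elem b r) ≡ rel (kreweras (π ↾ b)) (index b x e) r
      kreweras-↾-index {b} {x} e r = trans (cong (λ y → rel κ y (elem b r)) (sym (elem-index b x e))) (kreweras-↾ π preserving b _ r)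

      countTrue-block-↾ : ∀ {b x} (e : ℓ x ≡ b) → countTrue (rel κ x ∘ elem b) ≡ blockSize (kreweras (π ↾ b)) (index b x e)
      countTrue-block-↾ e = countTrue-cong (kreweras-↾-index e)

    blockSize-far : ∀ {b i} (e : ℓ i ≡ b) → ¬ z ∼[ kreweras π ] i →
      blockSize (kreweras π) i ≡ blockSize (kreweras (π ↾ b)) (index b i e)
    blockSize-far {b} {i} e far = begin
      countTrue (rel κ i)
        ≡⟨ countTrue-cong (λ j → sym (∧-by-implication (rel κ i j) (inBlock b j) (same-block j))) ⟩
      countTrue (λ j → inBlock b j ∧ rel κ i j)
        ≡⟨ countTrue-∘enum (inBlock b) (rel κ i) ⟨
      countTrue (rel κ i ∘ elem b)
        ≡⟨ countTrue-block-↾ e ⟩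
      blockSize (kreweras (π ↾ b)) (index b i e) ∎
      where
      open ≡-Reasoning
      same-block : ∀ j → i ∼[ κ ] j → inBlock b j ≡ true
      same-block j i∼j = inBlock-intro (trans (sym (far-labelPreserving far i∼j)) e)

    blockSize-hub : blockSize (kreweras π) z ≡ ∑[ b < suc d ] blockSize (kreweras (π ↾ b)) (index b (w b) (ℓ-w b))
    blockSize-hub = trans (countTrue-by-block (rel κ z)) (sum-cong-≗ λ b →
      trans (countTrue-cong {p = rel κ z ∘ elem b} {q = rel κ (w b) ∘ elem b} (λ r → ⇔→≡ (mk⇔
              (transP κ (w b) z (elem b r) (symP κ z (w b) (z∼κw b))) (transP κ z (w b) (elem b r) (z∼κw b)))))
            (countTrue-block-↾ (ℓ-w b)))

    kreweras-≡1-from-pieces : (∀ b r → blockSize (kreweras (π ↾ b)) r ≡ 1 [mod d ]) →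
      ∀ i → blockSize (kreweras π) i ≡ 1 [mod d ]
    kreweras-≡1-from-pieces pieces i = by-cases (rel κ z i ≟ᵇ true)
      where
      open SetoidReasoning (mod-setoid d)
      hub-pieces : Fin (suc d) → ℕ
      hub-pieces b = blockSize (kreweras (π ↾ b)) (index b (w b) (ℓ-w b))
      by-cases : Dec (z ∼[ κ ] i) → blockSize κ i ≡ 1 [mod d ]
      by-cases (no far) = mod-trans (mod-reflexive (blockSize-far refl far)) (pieces (ℓ i) (index (ℓ i) i refl))
      by-cases (yes z∼i) = begin
        blockSize κ i                ≡⟨ blockSize-∼ κ (symP κ z i z∼i) ⟩
        blockSize κ z                ≡⟨ blockSize-hub ⟩
        ∑[ b < suc d ] hub-pieces b  ≈⟨ ∑-cong-mod hub-pieces (λ _ → 1) (λ b → pieces b (index b (w b) (ℓ-w b))) ⟩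
        ∑[ b < suc d ] 1             ≡⟨ ∑-const-1 (suc d) ⟩
        1 + d                        ≈⟨ +-modulus 1 ⟩
        1                            ∎

    kreweras-pieces-≡1 : (∀ i → blockSize (kreweras π) i ≡ 1 [mod d ]) → (∀ i → blockSize π i ≡ 1 [mod d ]) →
      (∀ b → labelSize ℓ b ≡ 1 [mod d ]) → ∀ b r → blockSize (kreweras (π ↾ b)) r ≡ 1 [mod d ]
    kreweras-pieces-≡1 κ-blocks π-blocks sizes b r = by-cases (rel κ z (elem b r) ≟ᵇ true)
      where
      far-piece : ∀ t → ¬ z ∼[ κ ] elem b t → blockSize (kreweras (π ↾ b)) t ≡ 1 [mod d ]
      far-piece t far = mod-trans
        (mod-reflexive (sym (trans (blockSize-far (ℓ-elem b t) far) (cong (blockSize (kreweras (π ↾ b))) (index-elem b t)))))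
        (κ-blocks (elem b t))
      by-cases : Dec (z ∼[ κ ] elem b r) → blockSize (kreweras (π ↾ b)) r ≡ 1 [mod d ]
      by-cases (no far) = far-piece r far
      by-cases (yes z∼r) = kreweras-block≡1-mod (π ↾ b) (size>0 b) (↾-noncrossing π π-nc b) (sizes b)
        (λ t → mod-trans (mod-reflexive (blockSize-↾ π preserving b t)) (π-blocks (elem b t))) r
        (λ t r≁t → far-piece t λ z∼t → r≁t (trans (sym (kreweras-↾ π preserving b r t))
                                                  (transP κ (elem b r) z (elem b t) (symP κ z (elem b r) z∼r) z∼t)))

module IntervalDecomposition {d n} (d≥1 : 1 ≤ d) {σ : Partition n} (σ∈NC : InNC d σ)
  {ℓ : Fin n → Fin (suc d)} (labelling : BlockLabelling (suc d) σ ℓ) where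

  open KrewerasBelow {σ = σ} (proj₁ σ∈NC) labelling

  private
    ℓ-onto : ∀ b → ∃ λ i → ℓ i ≡ b
    ℓ-onto = proj₂ (proj₂ labelling)

    σ-kreweras-blocks : BlocksOneModD d (kreweras σ)
    σ-kreweras-blocks = ≡1⇒blocksOneModD {ρ = kreweras σ} (inNC-kreweras σ∈NC)

    z : Fin n
    z = proj₁ (σ-extra-exists d≥1)
    z-extra : extra σ (proj₁ σ∈NC) (λ _ _ i∼j → i∼j) z ≡ true
    z-extra = proj₂ (σ-extra-exists d≥1)

    meet : ∀ b → ∃ λ w → z ∼[ kreweras σ ] w × ℓ w ≡ b
    meet = extra-meets-every-block σ-kreweras-blocks z-extra

    w : Fin (suc d) → Fin n
    w b = proj₁ (meet b)

    module Hub (π : Partition n) (π-nc : NonCrossing π) (π≤σ : π ≤P σ) =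
      AroundHub z w (λ b → proj₁ (proj₂ (meet b))) (λ b → proj₂ (proj₂ (meet b))) π π-nc π≤σ

  labelSize≡1 : ∀ b → labelSize ℓ b ≡ 1 [mod d ]
  labelSize≡1 b = mod-trans (mod-reflexive (sym (trans (blockSize-σ i) (cong (labelSize ℓ) ℓi≡b)))) (inNC-blocks σ∈NC i)
    where
    i : Fin n
    i = proj₁ (ℓ-onto b)
    ℓi≡b : ℓ i ≡ b
    ℓi≡b = proj₂ (ℓ-onto b)

  ↾-inNC : ∀ {π} → InNC d π → π ≤P σ → ∀ b → InNC d (π ↾ b)
  ↾-inNC {π} π∈NC@(π-nc , _ , _) π≤σ b = inNC (↾-noncrossing π π-nc b)
    (λ r → mod-trans (mod-reflexive (blockSize-↾ π (≤σ⇒labelPreserving {π} π≤σ) b r)) (inNC-blocks π∈NC (elem b r)))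
    (Hub.kreweras-pieces-≡1 π π-nc π≤σ (inNC-kreweras π∈NC) (inNC-blocks π∈NC) labelSize≡1 b)

  split : Interval d n σ → ProdNC d (labelSize ℓ)
  split (π , π∈NC , π≤σ) b = π ↾ b , ↾-inNC π∈NC π≤σ b

  module Glue (x : ProdNC d (labelSize ℓ)) where

    private
      X : ∀ b → Partition (labelSize ℓ b)
      X b = proj₁ (x b)

    glueRel : ∀ i j → Dec (ℓ j ≡ ℓ i) → Bool
    glueRel i j (yes ℓj≡ℓi) = rel (X (ℓ i)) (index (ℓ i) i refl) (index (ℓ i) j ℓj≡ℓi)
    glueRel i j (no _)      = false

    glueRel-index : ∀ {b i j} (ei : ℓ i ≡ b) (ej : ℓ j ≡ b) (ℓj≟ℓi : Dec (ℓ j ≡ ℓ i)) →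
      glueRel i j ℓj≟ℓi ≡ rel (X b) (index b i ei) (index b j ej)
    glueRel-index {i = i} {j} refl ej (yes ℓj≡ℓi) =
      cong (rel (X (ℓ i)) (index (ℓ i) i refl)) (rank-irrelevant (inBlock (ℓ i)) j _ _)
    glueRel-index refl ej (no ℓj≢ℓi) = contradiction ej ℓj≢ℓi

    glueRel-labels : ∀ {i j} (ℓj≟ℓi : Dec (ℓ j ≡ ℓ i)) → glueRel i j ℓj≟ℓi ≡ true → ℓ j ≡ ℓ i
    glueRel-labels (yes ℓj≡ℓi) _ = ℓj≡ℓi

    glue : Partition n
    glue = record
      { rel    = λ i j → glueRel i j (ℓ j ≟ ℓ i)
      ; reflP  = λ i → trans (glueRel-index refl refl (ℓ i ≟ ℓ i)) (reflP (X (ℓ i)) _)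
      ; symP   = glue-sym
      ; transP = glue-trans
      }
      where
      glue-sym : ∀ i j → glueRel i j (ℓ j ≟ ℓ i) ≡ true → glueRel j i (ℓ i ≟ ℓ j) ≡ true
      glue-sym i j ij = trans (glueRel-index ej refl (ℓ i ≟ ℓ j))
                               (symP (X (ℓ i)) _ _ (trans (sym (glueRel-index refl ej (ℓ j ≟ ℓ i))) ij))
        where
        ej : ℓ j ≡ ℓ i
        ej = glueRel-labels (ℓ j ≟ ℓ i) ij
      glue-trans : ∀ i j k → glueRel i j (ℓ j ≟ ℓ i) ≡ true → glueRel j k (ℓ k ≟ ℓ j) ≡ true →
                   glueRel i k (ℓ k ≟ ℓ i) ≡ true
      glue-trans i j k ij jk = trans (glueRel-index refl ek (ℓ k ≟ ℓ i))
        (transP (X (ℓ i)) _ _ _ (trans (sym (glueRel-index refl ej (ℓ j ≟ ℓ i))) ij)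
                                (trans (sym (glueRel-index ej ek (ℓ k ≟ ℓ j))) jk))
        where
        ej : ℓ j ≡ ℓ i
        ej = glueRel-labels (ℓ j ≟ ℓ i) ij
        ek : ℓ k ≡ ℓ i
        ek = trans (glueRel-labels (ℓ k ≟ ℓ j) jk) ej

    glue-labelPreserving : LabelPreserving glue
    glue-labelPreserving i j ij = sym (glueRel-labels (ℓ j ≟ ℓ i) ij)

    glue-↾ : ∀ b → glue ↾ b ≈P X b
    glue-↾ b r t = trans (glueRel-index (ℓ-elem b r) (ℓ-elem b t) (ℓ (elem b t) ≟ ℓ (elem b r)))
                         (cong₂ (rel (X b)) (index-elem b r) (index-elem b t))

    glue-↾-inNC : ∀ b → InNC d (glue ↾ b)
    glue-↾-inNC b = inNC-cong {ρ = X b} {glue ↾ b} (λ r t → sym (glue-↾ b r t)) (proj₂ (x b))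

    glue-noncrossing : NonCrossing glue
    glue-noncrossing = noncrossing-from-pieces {glue} glue-labelPreserving (λ b → proj₁ (glue-↾-inNC b))

    glue≤σ : glue ≤P σ
    glue≤σ = labelPreserving⇒≤σ {glue} glue-labelPreserving

    glue-inNC : InNC d glue
    glue-inNC = inNC glue-noncrossing blocks
      (Hub.kreweras-≡1-from-pieces glue glue-noncrossing glue≤σ (λ b → inNC-kreweras (glue-↾-inNC b)))
      where
      blocks : ∀ i → blockSize glue i ≡ 1 [mod d ]
      blocks i = mod-trans (mod-reflexive (trans (cong (blockSize glue) (sym (elem-index (ℓ i) i refl)))
                                                 (sym (blockSize-↾ glue glue-labelPreserving (ℓ i) _))))
                           (inNC-blocks (glue-↾-inNC (ℓ i)) _)

  split-isOrderIsomorphism : IsOrderIsomorphism (_≈I_ {d} {n} {σ}) _≈Π_ (_≤I_ {d} {n} {σ}) _≤Π_ split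
  split-isOrderIsomorphism = record
    { isOrderMonomorphism = record
      { isOrderHomomorphism = record
        { cong = λ x≈y b r t → x≈y (elem b r) (elem b t)
        ; mono = λ x≤y b r t → x≤y (elem b r) (elem b t)
        }
      ; injective = λ {(π , _ , π≤σ)} {(ρ , _ , ρ≤σ)} π↾≈ρ↾ → ≤P-antisym {ρ = π} {ρ}
          (↾-reflects-≤ {π} {ρ} (≤σ⇒labelPreserving {π} π≤σ) (λ b r t → trans (sym (π↾≈ρ↾ b r t))))
          (↾-reflects-≤ {ρ} {π} (≤σ⇒labelPreserving {ρ} ρ≤σ) (λ b r t → trans (π↾≈ρ↾ b r t)))
      ; cancel = λ {(π , _ , π≤σ)} {(ρ , _ , _)} π↾≤ρ↾ →
          ↾-reflects-≤ {π} {ρ} (≤σ⇒labelPreserving {π} π≤σ) π↾≤ρ↾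
      }
    ; surjective = λ x → (Glue.glue x , Glue.glue-inNC x , Glue.glue≤σ x) ,
        λ π≈glue b r t → trans (π≈glue (elem b r) (elem b t)) (Glue.glue-↾ x b r t)
    }

lemma3p8 : (d n : ℕ) → 1 ≤ d → (σ : Partition n) → IsCoatom d n σ →
    (ℓ : Fin n → Fin (suc d)) → BlockLabelling (suc d) σ ℓ →
    IntervalIsoProduct d n σ (labelSize ℓ)
lemma3p8 d n d≥1 σ (_ , σ∈NC , _) ℓ labelling = split , split-isOrderIsomorphism
  where open IntervalDecomposition d≥1 σ∈NC labelling
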